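{- Let $k\ge 1$ and $n\ge 1$ be integers, let $(l_1,\ldots,l_k)$ be a $k$-tuple of positive integers and put $L=l_1+\cdots+l_k$. Let $F_n^{(l_1,\ldots,l_k)}$ be the set of all $n$-configurations of the $(l_1,\ldots,l_k)$-tennis ball problem (defined below). Then $F_n^{(l_1,\ldots,l_k)}$ is the collection of flag bases of a flag matroid on the set $[nL]=\{1,\ldots,nL\}$. Moreover, for each $i$ with $1\le i\le k$, the $i$-th constituent of this flag matroid is the $n$-th $(l_1+\cdots+l_i,\; l_{i+1}+\cdots+l_k)$-tbp matroid, i.e. the nested matroid $M[(N^{l_1+\cdots+l_i}E^{l_{i+1}+\cdots+l_k})^n]$.
   Context: Nested matroids: let $P$ be a lattice path from $(0,0)$ to $(m,r)$ with steps $E=(1,0)$ and $N=(0,1)$, written as a word in $E,N$ (so $(N^aE^b)^n$ denotes $a$ steps $N$, then $b$ steps $E$, repeated $n$ times). For each lattice path $Q$ from $(0,0)$ to $(m,r)$ with steps $E,N$ that never goes above $P$, let $Q_N=\{i: \text{step } i \text{ of } Q \text{ is } N\}$. The sets $Q_N$ are the bases of a matroid $M[P]$ on $[m+r]$. For nonnegative integers $a,b$, the matroid $M[(N^aE^b)^n]$ is called the $n$-th $(a,b)$-tbp matroid. Quotients: for matroids $M,N$ on the same ground set, $M$ is a quotient of $N$ if every flat of $M$ is a flat of $N$. An ordered $k$-partition of a set $S$ is a $k$-tuple $(A_1,\ldots,A_k)$ of nonempty, pairwise disjoint sets whose union is $S$. A flag matroid is a pair $(S,\mathcal{F})$ where $\mathcal{F}$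 is a collection of ordered $k$-partitions of $S$ such that: (F1) for $1\le i\le k$, $\mathcal{B}_i=\{B_1\cup\cdots\cup B_i : (B_1,\ldots,B_k)\in\mathcal{F}\}$ is the set of bases of a matroid $M_i$ on $S$; (F2) for $1\le i\le k-1$, $M_i$ is a quotient of $M_{i+1}$; (F3) if $(A_1,\ldots,A_k)$ is an ordered $k$-partition of $S$ such that $A_1\cup\cdots\cup A_i$ is a basis of $M_i$ for every $1\le i\le k$, then $(A_1,\ldots,A_k)\in\mathcal{F}$. The elements of $\mathcal{F}$ are the flag bases and $M_1,\ldots,M_k$ are the constituents. The $(l_1,\ldots,l_k)$-tennis ball problem: there are balls numbered $1,2,\ldots$ and bins $\Gamma_1,\ldots,\Gamma_k$, initially empty. In turn $t$ ($t=1,2,\ldots$), balls $(t-1)L+1,\ldots,tL$ are put into $\Gamma_1$; then, successively for $j=2,\ldots,k$, exactly $l_j+l_{j+1}+\cdots+l_k$ of the balls currently in $\Gamma_{j-1}$ (chosen arbitrarily) are moved to $\Gamma_j$. After $n$ turns bin $\Gamma_j$ contains exactly $nl_j$ balls, and the balls in the bins form an ordered $k$-partition (contents of $\Gamma_1,\ldots,\Gamma_k$) of $[nL]$. An $n$-configuration is an ordered $k$-partition of $[nL]$ that arises in this way after $n$ turns for some choice of moves. -}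

module Defs where

open import Data.Nat using (ℕ; zero; suc; _+_; _*_; _∸_; _≤_; _<_; _≤ᵇ_; _<ᵇ_; pred)
open import Data.Bool using (Bool; true; false; if_then_else_; _∧_)
open import Data.Fin using (Fin; toℕ)
open import Data.Fin.Subset using (Subset; _∈_; _∉_; _⊆_; _∪_; _-_; ⁅_⁆; ∣_∣)
open import Data.Fin.Subset.Properties using (_∈?_)
open import Data.Maybe using (Maybe; just; nothing)
open import Data.List as List using (List; take; drop)
open import Data.List.Properties using (take++drop≡id)
open import Data.Nat.ListAction using (sum)
open import Data.Nat.ListAction.Properties using (sum-++)
open import Data.Vec as Vec using (Vec; lookup; tabulate; toList; cast; replicate; concat; _++_)
open import Data.Product using (Σ; ∃; ∃-syntax; _×_; _,_)
open import Relation.Nullary using (does)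
open import Relation.Binary.PropositionalEquality using (_≡_; refl; cong; sym; trans)

IsMatroid : {N : ℕ} → (Subset N → Set) → Set
IsMatroid {N} B =
  (∃[ X ] B X) ×
  (∀ X Y → B X → B Y → ∀ x → x ∈ X → x ∉ Y →
     ∃[ y ] (y ∈ Y × y ∉ X × B ((X - x) ∪ ⁅ y ⁆)))

Independent : {N : ℕ} → (Subset N → Set) → Subset N → Set
Independent B I = ∃[ X ] (B X × I ⊆ X)

HasRank : {N : ℕ} → (Subset N → Set) → Subset N → ℕ → Set
HasRank B X r =
  (∃[ I ] (Independent B I × I ⊆ X × ∣ I ∣ ≡ r)) ×
  (∀ I → Independent B I → I ⊆ X → ∣ I ∣ ≤ r)

IsFlat : {N : ℕ} → (Subset N → Set) → Subset N → Set
IsFlat B F = ∀ e → e ∉ F → ∀ r r' → HasRank B F r → HasRank B (F ∪ ⁅ e ⁆) r' → r < r'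

IsQuotient : {N : ℕ} → (Subset N → Set) → (Subset N → Set) → Set
IsQuotient B₁ B₂ = ∀ F → IsFlat B₁ F → IsFlat B₂ F

-- Ordered k-partitions of Fin N, encoded as p : Vec (Fin k) N
-- (element x lies in block number lookup p x, blocks 0-indexed).

IsOrderedPartition : {N k : ℕ} → Vec (Fin k) N → Set
IsOrderedPartition {N} {k} p = ∀ (j : Fin k) → ∃[ x ] (lookup p x ≡ j)

-- A₁ ∪ ⋯ ∪ A_{i+1} (i : Fin k is the 0-based index of the last block)
prefixUnion : {N k : ℕ} → Vec (Fin k) N → Fin k → Subset N
prefixUnion p i = tabulate (λ x → toℕ (lookup p x) ≤ᵇ toℕ i)

-- bases of the (i+1)-th constituent of a collection 𝓕 of ordered partitions
ConstituentBasis : {N k : ℕ} → (Vec (Fin k) N → Set) → Fin k → Subset N → Set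
ConstituentBasis 𝓕 i X = ∃[ p ] (𝓕 p × prefixUnion p i ≡ X)

IsFlagMatroid : {N k : ℕ} → (Vec (Fin k) N → Set) → Set
IsFlagMatroid {N} {k} 𝓕 =
  (∀ p → 𝓕 p → IsOrderedPartition p) ×
  (∀ i → IsMatroid (ConstituentBasis 𝓕 i)) ×
  (∀ (i j : Fin k) → suc (toℕ i) ≡ toℕ j →
     IsQuotient (ConstituentBasis 𝓕 i) (ConstituentBasis 𝓕 j)) ×
  (∀ p → IsOrderedPartition p → (∀ i → ConstituentBasis 𝓕 i (prefixUnion p i)) → 𝓕 p)

data Step : Set where
  E N : Step

isN : Step → Bool
isN E = false
isN N = true

countN : List Step → ℕ
countN List.[] = 0
countN (s List.∷ w) = (if isN s then 1 else 0) + countN w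

heightAt : ℕ → List Step → ℕ
heightAt i w = countN (take i w)

Below : {m : ℕ} → Vec Step m → Vec Step m → Set
Below Q P = ∀ i → heightAt i (toList Q) ≤ heightAt i (toList P)

stepsN : {m : ℕ} → Vec Step m → Subset m
stepsN Q = Vec.map isN Q

NestedBasis : {m : ℕ} → Vec Step m → Subset m → Set
NestedBasis {m} P B =
  ∃[ Q ] (countN (toList Q) ≡ countN (toList P) × Below Q P × stepsN Q ≡ B)

tbpPath : (a b n : ℕ) → Vec Step (n * (a + b))
tbpPath a b n = concat (replicate n (replicate a N ++ replicate b E))

total : {k : ℕ} → Vec ℕ k → ℕ
total l = sum (toList l)

-- l_{j} + ⋯ + l_k  for 1-based j
tailSum : {k : ℕ} → Vec ℕ k → ℕ → ℕ
tailSum l j = sum (drop (j ∸ 1) (toList l))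

-- l₁ + ⋯ + l_i and l_{i+1} + ⋯ + l_k for 1-based i
headSum : {k : ℕ} → Vec ℕ k → ℕ → ℕ
headSum l i = sum (take i (toList l))

-- State: ball number (toℕ b + 1) is either not yet in play, or in bin
-- number j (bins numbered 1,…,k).
State : ℕ → Set
State M = Vec (Maybe ℕ) M

-- turn number (t+1): balls tL+1,…,(t+1)L (0-based: t*L ≤ b < (t+1)*L)
-- are put into bin 1
insertTurn : {M : ℕ} → (L t : ℕ) → State M → State M
insertTurn L t s =
  tabulate (λ b → if (t * L ≤ᵇ toℕ b) ∧ (toℕ b <ᵇ suc t * L) then just 1 else lookup s b)

Move : {M : ℕ} → ℕ → ℕ → State M → State M → Set
Move {M} c j s s' =
  ∃[ S ] (∣ S ∣ ≡ c × (∀ b → b ∈ S → lookup s b ≡ just (pred j)) ×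
          s' ≡ tabulate (λ b → if does (b ∈? S) then just j else lookup s b))

data Moves {k : ℕ} (l : Vec ℕ k) {M : ℕ} : ℕ → State M → State M → Set where
  done : ∀ {j s} → k < j → Moves l j s s
  step : ∀ {j s s₁ s₂} → j ≤ k → Move (tailSum l j) j s s₁ →
         Moves l (suc j) s₁ s₂ → Moves l j s s₂

data Run {k : ℕ} (l : Vec ℕ k) {M : ℕ} : ℕ → State M → Set where
  start : Run l 0 (replicate M nothing)
  turn  : ∀ {t s s'} → Run l t s → Moves l 2 (insertTurn (total l) t s) s' →
          Run l (suc t) s'

-- n-configurations, as ordered k-partitions of [nL]
-- (ball toℕ b + 1 ends in bin toℕ (lookup p b) + 1)
Configuration : {k : ℕ} → (l : Vec ℕ k) → (n : ℕ) → Vec (Fin k) (n * total l) → Set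
Configuration l n p =
  ∃[ s ] (Run l n s × s ≡ Vec.map (λ x → just (suc (toℕ x))) p)

split-total : {k : ℕ} (l : Vec ℕ k) (i : ℕ) →
  total l ≡ headSum l i + tailSum l (suc i)
split-total l i =
  trans (cong sum (sym (take++drop≡id i (toList l))))
        (sum-++ (take i (toList l)) (drop i (toList l)))

TbpBasis : {k : ℕ} (l : Vec ℕ k) (n i : ℕ) → Subset (n * total l) → Set
TbpBasis l n i X =
  NestedBasis (tbpPath (headSum l i) (tailSum l (suc i)) n)
              (cast (cong (n *_) (split-total l i)) X)

{-# OPTIONS --safe #-}
-- An ordered partition p of [nL] is an n-configuration exactly when, for every j, the bins
-- j, …, k hold at least t (l_j + ⋯ + l_k) of the first tL balls for each t ≤ n, and
-- n (l_j + ⋯ + l_k) balls in all: necessity is an invariant of the moves (balls only move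
-- up), sufficiency schedules the balls greedily, turn by turn, from the top bin down.  For
-- the union X of the first i blocks these conditions say that the prefix counts of X stay
-- below the path (N^a E^b)^n, a = l₁ + ⋯ + l_i, b = L - a; conversely every such X extends
-- to a partition satisfying all the conditions.  Hence the i-th constituent is the nested
-- matroid M[(N^a E^b)^n].  Matroids given by an upper path are matroids (a greedy
-- algorithm computes the rank), and raising i turns E steps of the path into N steps, which
-- makes each constituent a quotient of the next; (F3) is the characterisation once more.

module Submission where

open import Data.Nat
open import Data.Nat.Properties
open import Data.Bool using (not)
open import Data.Fin using (Fin; toℕ; fromℕ<)
open import Data.Fin.Properties using (toℕ<n; toℕ-fromℕ<)
open import Data.Fin.Subset using (Subset; ∣_∣)
open import Data.Vec using (Vec; lookup; cast)
open import Data.Vec.Properties using (lookup∘tabulate; cast-is-id)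
open import Data.Product using (_×_; _,_)
open import Data.Sum using (inj₁; inj₂)
open import Function.Bundles using (_⇔_; mk⇔; Equivalence)
open import Function.Properties.Equivalence using () renaming (trans to ⇔-trans; sym to ⇔-sym)
open import Relation.Binary.PropositionalEquality
open import Defs

module Counting where

  open import Data.Nat
  open import Data.Nat.Properties
  open import Data.Nat.Tactic.RingSolver using (solve-∀)
  open import Algebra.Properties.CommutativeSemigroup +-commutativeSemigroup using (interchange)
  open import Data.Bool using (Bool; true; false; _∧_; _∨_; not)
  open import Data.Bool.Properties using (∧-zeroʳ; ∧-identityʳ; ∨-zeroʳ; ∨-identityʳ; T-≡)
  open import Data.Fin using (Fin; toℕ; zero; suc)
  open import Data.Fin.Properties using (toℕ-fromℕ<)
  open import Data.Fin.Subset using (Subset; _∈_; _∉_; ∣_∣; _∪_; _─_; ⁅_⁆; _⊆_; ⊥)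
  open import Data.Fin.Subset.Properties using (_∈?_)
  open import Data.Vec using ([]; _∷_; lookup; tabulate)
  open import Data.Vec.Properties using ([]=⇒lookup; lookup⇒[]=)
  open import Data.Product using (∃-syntax; _×_; _,_)
  open import Data.Sum using (_⊎_; inj₁; inj₂)
  open import Data.Empty using (⊥-elim)
  open import Function.Bundles using (Equivalence)
  open import Relation.Nullary using (¬_; yes; no; does)
  open import Relation.Nullary.Decidable using (dec-true; dec-false)
  open import Relation.Binary.PropositionalEquality

  private
    variable
      m n : ℕ

  false≢true : false ≢ true
  false≢true ()

  ∨≡true⇒ : ∀ {a b} → (a ∨ b) ≡ true → a ≡ true ⊎ b ≡ true
  ∨≡true⇒ {true} _ = inj₁ refl
  ∨≡true⇒ {false} e = inj₂ e

  ∨≡trueˡ : ∀ {a} b → a ≡ true → (a ∨ b) ≡ true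
  ∨≡trueˡ b refl = refl

  ∨≡trueʳ : ∀ a {b} → b ≡ true → (a ∨ b) ≡ true
  ∨≡trueʳ true _ = refl
  ∨≡trueʳ false e = e

  ∧≡true⇒ˡ : ∀ {a b} → (a ∧ b) ≡ true → a ≡ true
  ∧≡true⇒ˡ {true} _ = refl

  ∧≡true⇒ʳ : ∀ {a b} → (a ∧ b) ≡ true → b ≡ true
  ∧≡true⇒ʳ {true} e = e

  ∧≡true : ∀ {a b} → a ≡ true → b ≡ true → (a ∧ b) ≡ true
  ∧≡true refl refl = refl

  not≡true⇒ : ∀ {a} → not a ≡ true → a ≡ false
  not≡true⇒ {false} _ = refl

  not≡true : ∀ {a} → a ≡ false → not a ≡ true
  not≡true refl = refl

  ≤⇒≤ᵇ≡true : m ≤ n → (m ≤ᵇ n) ≡ true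
  ≤⇒≤ᵇ≡true {m} {n} = dec-true (m ≤? n)

  >⇒≤ᵇ≡false : n < m → (m ≤ᵇ n) ≡ false
  >⇒≤ᵇ≡false {n} {m} n<m = dec-false (m ≤? n) (<⇒≱ n<m)

  <⇒<ᵇ≡true : m < n → (m <ᵇ n) ≡ true
  <⇒<ᵇ≡true {m} {n} = dec-true (m <? n)

  ≮⇒<ᵇ≡false : ¬ m < n → (m <ᵇ n) ≡ false
  ≮⇒<ᵇ≡false {m} {n} = dec-false (m <? n)

  ≡ᵇ-refl : ∀ n → (n ≡ᵇ n) ≡ true
  ≡ᵇ-refl n = dec-true (n ≟ n) refl

  ≢⇒≡ᵇ≡false : m ≢ n → (m ≡ᵇ n) ≡ false
  ≢⇒≡ᵇ≡false {m} {n} = dec-false (m ≟ n)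

  ≤ᵇ≡true⇒≤ : (m ≤ᵇ n) ≡ true → m ≤ n
  ≤ᵇ≡true⇒≤ {m} {n} e = ≤ᵇ⇒≤ m n (Equivalence.from T-≡ e)

  <ᵇ≡true⇒< : (m <ᵇ n) ≡ true → m < n
  <ᵇ≡true⇒< {m} {n} e = <ᵇ⇒< m n (Equivalence.from T-≡ e)

  ≤ᵇ≡false⇒> : (m ≤ᵇ n) ≡ false → n < m
  ≤ᵇ≡false⇒> {m} {n} e with n <? m
  ... | yes n<m = n<m
  ... | no n≮m = ⊥-elim (false≢true (trans (sym e) (≤⇒≤ᵇ≡true (≮⇒≥ n≮m))))

  bit : Bool → ℕ
  bit true = 1
  bit false = 0

  bit≤1 : ∀ b → bit b ≤ 1
  bit≤1 true = ≤-refl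
  bit≤1 false = z≤n

  bit-mono : ∀ {a b} → (a ≡ true → b ≡ true) → bit a ≤ bit b
  bit-mono {false} _ = z≤n
  bit-mono {true} a⇒b rewrite a⇒b refl = ≤-refl

  count : (ℕ → Bool) → ℕ → ℕ
  count f zero = 0
  count f (suc j) = count f j + bit (f j)

  infix 4 _⊆ᵇ_
  _⊆ᵇ_ : (ℕ → Bool) → (ℕ → Bool) → Set
  f ⊆ᵇ g = ∀ i → f i ≡ true → g i ≡ true

  count-suc-true : ∀ f i → f i ≡ true → count f (suc i) ≡ suc (count f i)
  count-suc-true f i fi rewrite fi = +-comm _ 1

  count-suc-false : ∀ f i → f i ≡ false → count f (suc i) ≡ count f i
  count-suc-false f i fi rewrite fi = +-identityʳ _

  count-false : ∀ j → count (λ _ → false) j ≡ 0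
  count-false zero = refl
  count-false (suc j) = trans (+-identityʳ _) (count-false j)

  count-shift : ∀ f j → count f (suc j) ≡ bit (f 0) + count (λ i → f (suc i)) j
  count-shift f zero = +-comm 0 (bit (f 0))
  count-shift f (suc j) = trans (cong (_+ bit (f (suc j))) (count-shift f j)) (+-assoc (bit (f 0)) _ _)

  count-ext : ∀ {f g} j → (∀ i → i < j → f i ≡ g i) → count f j ≡ count g j
  count-ext zero _ = refl
  count-ext (suc j) f≗g = cong₂ _+_ (count-ext j (λ i i<j → f≗g i (m<n⇒m<1+n i<j))) (cong bit (f≗g j ≤-refl))

  count-mono : ∀ {f g} j → f ⊆ᵇ g → count f j ≤ count g j
  count-mono zero _ = z≤n
  count-mono (suc j) f⊆g = +-mono-≤ (count-mono j f⊆g) (bit-mono (f⊆g j))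

  count-monoʳ : ∀ f {j j'} → j ≤ j' → count f j ≤ count f j'
  count-monoʳ f {j} {zero} z≤n = ≤-refl
  count-monoʳ f {j} {suc j'} j≤ with m≤n⇒m<n∨m≡n j≤
  ... | inj₂ refl = ≤-refl
  ... | inj₁ (s≤s j≤j') = ≤-trans (count-monoʳ f j≤j') (m≤m+n _ _)

  count≤ : ∀ f j → count f j ≤ j
  count≤ f zero = z≤n
  count≤ f (suc j) = ≤-trans (+-mono-≤ (count≤ f j) (bit≤1 (f j))) (≤-reflexive (+-comm j 1))

  count-+ : ∀ f j r → count f (j + r) ≤ count f j + r
  count-+ f j zero = ≤-reflexive (trans (cong (count f) (+-identityʳ j)) (sym (+-identityʳ _)))
  count-+ f j (suc r) = begin
    count f (j + suc r)              ≡⟨ cong (count f) (+-suc j r) ⟩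
    count f (j + r) + bit (f (j + r)) ≤⟨ +-mono-≤ (count-+ f j r) (bit≤1 (f (j + r))) ⟩
    count f j + r + 1                ≡⟨ +-assoc (count f j) r 1 ⟩
    count f j + (r + 1)              ≡⟨ cong (count f j +_) (+-comm r 1) ⟩
    count f j + suc r                ∎
    where open ≤-Reasoning

  count-constant : ∀ f {j j'} → j ≤ j' → (∀ i → j ≤ i → i < j' → f i ≡ false) → count f j' ≡ count f j
  count-constant f {j} {j'} j≤ none with m≤n⇒m<n∨m≡n j≤
  ... | inj₂ refl = refl
  count-constant f {j} {suc j'} j≤ none | inj₁ (s≤s j≤j') =
    trans (count-suc-false f j' (none j' j≤j' ≤-refl))
          (count-constant f j≤j' (λ i j≤i i<j' → none i j≤i (m<n⇒m<1+n i<j')))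

  count-all : ∀ f j → (∀ i → i < j → f i ≡ true) → count f j ≡ j
  count-all f zero _ = refl
  count-all f (suc j) all = trans (count-suc-true f j (all j ≤-refl))
                                  (cong suc (count-all f j (λ i i<j → all i (m<n⇒m<1+n i<j))))

  count-<ᵇ : ∀ w j → count (_<ᵇ w) j ≡ j ⊓ w
  count-<ᵇ w zero = refl
  count-<ᵇ w (suc j) with j <? w
  ... | yes j<w rewrite <⇒<ᵇ≡true j<w | count-<ᵇ w j | m≤n⇒m⊓n≡m (<⇒≤ j<w) | m≤n⇒m⊓n≡m j<w = +-comm j 1
  ... | no j≮w rewrite ≮⇒<ᵇ≡false j≮w | count-<ᵇ w j | m≥n⇒m⊓n≡n (≮⇒≥ j≮w)
                     | m≥n⇒m⊓n≡n (≤-trans (≮⇒≥ j≮w) (n≤1+n j)) = +-identityʳ w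

  count-downClosed : ∀ R K → (∀ u v → u ≤ v → v < K → R v ≡ true → R u ≡ true) →
    ∀ w → w < K → (suc w ≤ᵇ count R K) ≡ R w
  count-downClosed R K closed w w<K with R w in Rw
  ... | true = ≤⇒≤ᵇ≡true (begin
    suc w             ≡⟨ count-all R (suc w) (λ u u≤w → closed u w (≤-pred u≤w) w<K Rw) ⟨
    count R (suc w)   ≤⟨ count-monoʳ R w<K ⟩
    count R K         ∎)
    where open ≤-Reasoning
  ... | false = >⇒≤ᵇ≡false (s≤s (≤-trans (≤-reflexive (count-constant R (<⇒≤ w<K) above)) (count≤ R w)))
    where
    above : ∀ u → w ≤ u → u < K → R u ≡ false
    above u w≤u u<K with R u in Ru
    ... | false = refl
    ... | true = ⊥-elim (false≢true (trans (sym Rw) (closed w u w≤u u<K Ru)))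

  count-pos : ∀ f i j → i < j → f i ≡ true → 0 < count f j
  count-pos f i (suc j) i<1+j fi with m≤n⇒m<n∨m≡n (≤-pred i<1+j)
  ... | inj₁ i<j = ≤-trans (count-pos f i j i<j fi) (m≤m+n _ _)
  ... | inj₂ refl rewrite fi = m≤n+m 1 _

  count-pos⇒last : ∀ f j → 0 < count f j →
    ∃[ i ] (i < j × f i ≡ true × (∀ i' → i < i' → i' < j → f i' ≡ false))
  count-pos⇒last f (suc j) pos with f j in fj
  ... | true = j , ≤-refl , fj , λ i' j<i' i'<1+j → ⊥-elim (<-irrefl refl (<-≤-trans j<i' (≤-pred i'<1+j)))
  ... | false with count-pos⇒last f j (subst (0 <_) (+-identityʳ _) pos)
  ... | i , i<j , fi , none = i , m<n⇒m<1+n i<j , fi , none′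
    where
    none′ : ∀ i' → i < i' → i' < suc j → f i' ≡ false
    none′ i' i<i' i'<1+j with m≤n⇒m<n∨m≡n (≤-pred i'<1+j)
    ... | inj₁ i'<j = none i' i<i' i'<j
    ... | inj₂ refl = fj

  count-not : ∀ f j → count (λ i → not (f i)) j + count f j ≡ j
  count-not f zero = refl
  count-not f (suc j) = begin
    (count (λ i → not (f i)) j + bit (not (f j))) + (count f j + bit (f j)) ≡⟨ interchange (count (λ i → not (f i)) j) _ (count f j) _ ⟩
    (count (λ i → not (f i)) j + count f j) + (bit (not (f j)) + bit (f j)) ≡⟨ cong₂ _+_ (count-not f j) (bit-not (f j)) ⟩
    j + 1                                                                   ≡⟨ +-comm j 1 ⟩
    suc j                                                                   ∎
    where
    open ≡-Reasoning
    bit-not : ∀ b → bit (not b) + bit b ≡ 1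
    bit-not true = refl
    bit-not false = refl

  count-∨ : ∀ f g → (∀ i → f i ≡ true → g i ≡ false) → ∀ j →
    count (λ i → f i ∨ g i) j ≡ count f j + count g j
  count-∨ f g disjoint zero = refl
  count-∨ f g disjoint (suc j) = begin
    count (λ i → f i ∨ g i) j + bit (f j ∨ g j)       ≡⟨ cong₂ _+_ (count-∨ f g disjoint j) (bit-∨ (f j) (g j) (disjoint j)) ⟩
    (count f j + count g j) + (bit (f j) + bit (g j)) ≡⟨ interchange (count f j) (count g j) (bit (f j)) (bit (g j)) ⟩
    (count f j + bit (f j)) + (count g j + bit (g j)) ∎
    where
    open ≡-Reasoning
    bit-∨ : ∀ a b → (a ≡ true → b ≡ false) → bit (a ∨ b) ≡ bit a + bit b
    bit-∨ true b a⇒¬b rewrite a⇒¬b refl = refl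
    bit-∨ false b _ = refl

  count-∧-not : ∀ f g → f ⊆ᵇ g → ∀ j → count (λ i → g i ∧ not (f i)) j + count f j ≡ count g j
  count-∧-not f g f⊆g zero = refl
  count-∧-not f g f⊆g (suc j) = begin
    (count g∖f j + bit (g j ∧ not (f j))) + (count f j + bit (f j)) ≡⟨ interchange (count g∖f j) (bit (g j ∧ not (f j))) (count f j) (bit (f j)) ⟩
    (count g∖f j + count f j) + (bit (g j ∧ not (f j)) + bit (f j)) ≡⟨ cong₂ _+_ (count-∧-not f g f⊆g j) (bit-∧-not (f j) (g j) (f⊆g j)) ⟩
    count g j + bit (g j)                                           ∎
    where
    open ≡-Reasoning
    g∖f : ℕ → Bool
    g∖f i = g i ∧ not (f i)
    bit-∧-not : ∀ a b → (a ≡ true → b ≡ true) → bit (b ∧ not a) + bit a ≡ bit b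
    bit-∧-not true b a⇒b rewrite a⇒b refl = refl
    bit-∧-not false true _ = refl
    bit-∧-not false false _ = refl

  count-split : ∀ (f g : ℕ → Bool) j → count f j ≡ count (λ i → f i ∧ g i) j + count (λ i → f i ∧ not (g i)) j
  count-split f g zero = refl
  count-split f g (suc j) = begin
    count f j + bit (f j)                                            ≡⟨ cong₂ _+_ (count-split f g j) (bit-split (f j) (g j)) ⟩
    (count f∩g j + count f∖g j) + (bit (f j ∧ g j) + bit (f j ∧ not (g j))) ≡⟨ interchange (count f∩g j) (count f∖g j) (bit (f j ∧ g j)) (bit (f j ∧ not (g j))) ⟩
    (count f∩g j + bit (f j ∧ g j)) + (count f∖g j + bit (f j ∧ not (g j))) ∎
    where
    open ≡-Reasoning
    f∩g f∖g : ℕ → Bool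
    f∩g i = f i ∧ g i
    f∖g i = f i ∧ not (g i)
    bit-split : ∀ a b → bit a ≡ bit (a ∧ b) + bit (a ∧ not b)
    bit-split false _ = refl
    bit-split true true = refl
    bit-split true false = refl

  count-growth : ∀ {f g j j'} → (∀ i → j ≤ i → i < j' → f i ≡ true → g i ≡ true) → j ≤ j' →
    count f j' + count g j ≤ count g j' + count f j
  count-growth {f} {g} {j} {j'} f⊆g j≤ with m≤n⇒m<n∨m≡n j≤
  ... | inj₂ refl = ≤-reflexive (+-comm (count f j) (count g j))
  count-growth {f} {g} {j} {suc j'} f⊆g j≤ | inj₁ (s≤s j≤j') = begin
    count f j' + bit (f j') + count g j ≡⟨ swap (count f j') (bit (f j')) (count g j) ⟩
    count f j' + count g j + bit (f j') ≤⟨ +-mono-≤ (count-growth (λ i j≤i i<j' → f⊆g i j≤i (m<n⇒m<1+n i<j')) j≤j')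
                                                    (bit-mono (f⊆g j' j≤j' ≤-refl)) ⟩
    count g j' + count f j + bit (g j') ≡⟨ swap (count g j') (count f j) (bit (g j')) ⟩
    count g j' + bit (g j') + count f j ∎
    where
    open ≤-Reasoning
    swap : ∀ x y z → x + y + z ≡ x + z + y
    swap = solve-∀

  count-growth-strict : ∀ {f g j a j'} → (∀ i → j ≤ i → i < j' → f i ≡ true → g i ≡ true) →
    j ≤ a → a < j' → f a ≡ false → g a ≡ true →
    suc (count f j' + count g j) ≤ count g j' + count f j
  count-growth-strict {f} {g} {j} {a} {j'} f⊆g j≤a a<j' fa ga =
    +-cancelˡ-≤ (count g a + count f a) _ _
      (subst₂ _≤_ (lhs (count f a) (count g j) (count f j') (count g a))
                  (rhs (count g a) (count f j) (count g j') (count f a))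
                  (+-mono-≤ below above))
    where
    below : count f a + count g j ≤ count g a + count f j
    below = count-growth (λ i j≤i i<a → f⊆g i j≤i (<-trans i<a a<j')) j≤a
    above : count f j' + suc (count g a) ≤ count g j' + count f a
    above = subst₂ (λ u v → count f j' + u ≤ count g j' + v) (count-suc-true g a ga) (count-suc-false f a fa)
              (count-growth (λ i a<i i<j' → f⊆g i (≤-trans j≤a (<⇒≤ a<i)) i<j') a<j')
    lhs : ∀ fa gj fj' ga → (fa + gj) + (fj' + suc ga) ≡ (ga + fa) + suc (fj' + gj)
    lhs = solve-∀
    rhs : ∀ ga fj gj' fa → (ga + fj) + (gj' + fa) ≡ (ga + fa) + (gj' + fj)
    rhs = solve-∀

  module AddPoint (f g : ℕ → Bool) (a : ℕ) (same : ∀ i → i ≢ a → f i ≡ g i)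
                  (fa : f a ≡ true) (ga : g a ≡ false) where

    count-≤ : ∀ j → j ≤ a → count g j ≡ count f j
    count-≤ j j≤a = count-ext j (λ i i<j → sym (same i (λ i≡a → <-irrefl i≡a (<-≤-trans i<j j≤a))))

    count-> : ∀ j → a < j → suc (count g j) ≡ count f j
    count-> (suc j) (s≤s a≤j) with m≤n⇒m<n∨m≡n a≤j
    ... | inj₂ refl rewrite fa | ga = trans (cong suc (trans (+-identityʳ _) (count-≤ a ≤-refl))) (+-comm 1 (count f a))
    ... | inj₁ a<j rewrite same j (λ j≡a → <-irrefl (sym j≡a) a<j) = cong (_+ bit (g j)) (count-> j a<j)

  count-insert-≤ : ∀ A a → A a ≡ false → ∀ j → j ≤ a → count (λ i → A i ∨ (i ≡ᵇ a)) j ≡ count A j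
  count-insert-≤ A a a∉A j j≤a = sym (AddPoint.count-≤ (λ i → A i ∨ (i ≡ᵇ a)) A a
    (λ i i≢a → trans (cong (A i ∨_) (≢⇒≡ᵇ≡false i≢a)) (∨-identityʳ (A i)))
    (trans (cong (A a ∨_) (≡ᵇ-refl a)) (∨-zeroʳ (A a))) a∉A j j≤a)

  count-insert-> : ∀ A a → A a ≡ false → ∀ j → a < j → count (λ i → A i ∨ (i ≡ᵇ a)) j ≡ suc (count A j)
  count-insert-> A a a∉A j a<j = sym (AddPoint.count-> (λ i → A i ∨ (i ≡ᵇ a)) A a
    (λ i i≢a → trans (cong (A i ∨_) (≢⇒≡ᵇ≡false i≢a)) (∨-identityʳ (A i)))
    (trans (cong (A a ∨_) (≡ᵇ-refl a)) (∨-zeroʳ (A a))) a∉A j a<j)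

  count-remove-≤ : ∀ A a → A a ≡ true → ∀ j → j ≤ a → count (λ i → A i ∧ not (i ≡ᵇ a)) j ≡ count A j
  count-remove-≤ A a a∈A = AddPoint.count-≤ A (λ i → A i ∧ not (i ≡ᵇ a)) a
    (λ i i≢a → sym (trans (cong (λ b → A i ∧ not b) (≢⇒≡ᵇ≡false i≢a)) (∧-identityʳ (A i))))
    a∈A (trans (cong (λ b → A a ∧ not b) (≡ᵇ-refl a)) (∧-zeroʳ (A a)))

  count-remove-> : ∀ A a → A a ≡ true → ∀ j → a < j → suc (count (λ i → A i ∧ not (i ≡ᵇ a)) j) ≡ count A j
  count-remove-> A a a∈A = AddPoint.count-> A (λ i → A i ∧ not (i ≡ᵇ a)) a
    (λ i i≢a → sym (trans (cong (λ b → A i ∧ not b) (≢⇒≡ᵇ≡false i≢a)) (∧-identityʳ (A i))))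
    a∈A (trans (cong (λ b → A a ∧ not b) (≡ᵇ-refl a)) (∧-zeroʳ (A a)))

  first : ℕ → (ℕ → Bool) → ℕ → Bool
  first c A i = A i ∧ (count A i <ᵇ c)

  first⊆ : ∀ c A → first c A ⊆ᵇ A
  first⊆ c A i = ∧≡true⇒ˡ

  first-mono : ∀ {c c'} A → c ≤ c' → first c A ⊆ᵇ first c' A
  first-mono A c≤c' i e = ∧≡true (∧≡true⇒ˡ e) (<⇒<ᵇ≡true (<-≤-trans (<ᵇ≡true⇒< (∧≡true⇒ʳ {A i} e)) c≤c'))

  count-first : ∀ c A j → count (first c A) j ≡ c ⊓ count A j
  count-first c A zero = sym (⊓-zeroʳ c)
  count-first c A (suc j) with A j | count-first c A j
  ... | false | ih = trans (+-identityʳ _) (trans ih (cong (c ⊓_) (sym (+-identityʳ _))))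
  ... | true | ih with count A j <? c
  ...   | yes lt rewrite <⇒<ᵇ≡true lt | ih | m≥n⇒m⊓n≡n (<⇒≤ lt)
                       | m≥n⇒m⊓n≡n (subst (_≤ c) (+-comm 1 (count A j)) lt) = refl
  ...   | no nlt rewrite ≮⇒<ᵇ≡false nlt | ih | m≤n⇒m⊓n≡m (≮⇒≥ nlt)
                       | m≤n⇒m⊓n≡m (≤-trans (≮⇒≥ nlt) (m≤m+n (count A j) 1)) = +-identityʳ c

  -- A subset of Fin m read as a predicate on ℕ, false outside [0, m).
  infix 4 _∈ᵇ_
  _∈ᵇ_ : ℕ → Subset m → Bool
  _ ∈ᵇ [] = false
  zero ∈ᵇ (b ∷ X) = b
  suc j ∈ᵇ (b ∷ X) = j ∈ᵇ X

  fromPred : (ℕ → Bool) → Subset m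
  fromPred g = tabulate (λ x → g (toℕ x))

  ∈ᵇ-lookup : (X : Subset m) (x : Fin m) → (toℕ x ∈ᵇ X) ≡ lookup X x
  ∈ᵇ-lookup (b ∷ X) zero = refl
  ∈ᵇ-lookup (b ∷ X) (suc x) = ∈ᵇ-lookup X x

  ∈ᵇ-out : ∀ (X : Subset m) j → m ≤ j → (j ∈ᵇ X) ≡ false
  ∈ᵇ-out [] j _ = refl
  ∈ᵇ-out (b ∷ X) (suc j) (s≤s m≤j) = ∈ᵇ-out X j m≤j

  ∈ᵇ⇒< : ∀ (X : Subset m) j → (j ∈ᵇ X) ≡ true → j < m
  ∈ᵇ⇒< {m} X j j∈X with j <? m
  ... | yes j<m = j<m
  ... | no j≮m = ⊥-elim (false≢true (trans (sym (∈ᵇ-out X j (≮⇒≥ j≮m))) j∈X))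

  ∈⇒∈ᵇ : {X : Subset m} {x : Fin m} → x ∈ X → (toℕ x ∈ᵇ X) ≡ true
  ∈⇒∈ᵇ {X = X} {x} x∈X = trans (∈ᵇ-lookup X x) ([]=⇒lookup x∈X)

  ∈ᵇ⇒∈ : {X : Subset m} {x : Fin m} → (toℕ x ∈ᵇ X) ≡ true → x ∈ X
  ∈ᵇ⇒∈ {X = X} {x} e = lookup⇒[]= x X (trans (sym (∈ᵇ-lookup X x)) e)

  ∈ᵇ-fromPred : ∀ (g : ℕ → Bool) j → j < m → (j ∈ᵇ fromPred {m} g) ≡ g j
  ∈ᵇ-fromPred {suc m} g zero _ = refl
  ∈ᵇ-fromPred {suc m} g (suc j) (s≤s j<m) = ∈ᵇ-fromPred {m} (λ i → g (suc i)) j j<m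

  ∈ᵇ-fromPred-total : ∀ (g : ℕ → Bool) → (∀ j → m ≤ j → g j ≡ false) → ∀ j → (j ∈ᵇ fromPred {m} g) ≡ g j
  ∈ᵇ-fromPred-total {m} g out j with j <? m
  ... | yes j<m = ∈ᵇ-fromPred g j j<m
  ... | no j≮m = trans (∈ᵇ-out (fromPred {m} g) j (≮⇒≥ j≮m)) (sym (out j (≮⇒≥ j≮m)))

  ∈ᵇ-∪ : ∀ (X Y : Subset m) j → (j ∈ᵇ X ∪ Y) ≡ ((j ∈ᵇ X) ∨ (j ∈ᵇ Y))
  ∈ᵇ-∪ [] [] j = refl
  ∈ᵇ-∪ (x ∷ X) (y ∷ Y) zero = refl
  ∈ᵇ-∪ (x ∷ X) (y ∷ Y) (suc j) = ∈ᵇ-∪ X Y j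

  ∈ᵇ-─ : ∀ (X Y : Subset m) j → (j ∈ᵇ X ─ Y) ≡ ((j ∈ᵇ X) ∧ not (j ∈ᵇ Y))
  ∈ᵇ-─ [] [] j = refl
  ∈ᵇ-─ (x ∷ X) (true ∷ Y) zero = sym (∧-zeroʳ x)
  ∈ᵇ-─ (x ∷ X) (false ∷ Y) zero = sym (∧-identityʳ x)
  ∈ᵇ-─ (x ∷ X) (true ∷ Y) (suc j) = ∈ᵇ-─ X Y j
  ∈ᵇ-─ (x ∷ X) (false ∷ Y) (suc j) = ∈ᵇ-─ X Y j

  ∈ᵇ-⊥ : ∀ j → (j ∈ᵇ ⊥ {m}) ≡ false
  ∈ᵇ-⊥ {zero} j = refl
  ∈ᵇ-⊥ {suc m} zero = refl
  ∈ᵇ-⊥ {suc m} (suc j) = ∈ᵇ-⊥ {m} j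

  ∈ᵇ-⁅⁆ : ∀ (y : Fin m) j → (j ∈ᵇ ⁅ y ⁆) ≡ (j ≡ᵇ toℕ y)
  ∈ᵇ-⁅⁆ zero zero = refl
  ∈ᵇ-⁅⁆ {suc m} zero (suc j) = ∈ᵇ-⊥ {m} j
  ∈ᵇ-⁅⁆ (suc y) zero = refl
  ∈ᵇ-⁅⁆ (suc y) (suc j) = ∈ᵇ-⁅⁆ y j

  ⊆⇒⊆ᵇ : {X Y : Subset m} → X ⊆ Y → (_∈ᵇ X) ⊆ᵇ (_∈ᵇ Y)
  ⊆⇒⊆ᵇ {X = X} {Y} X⊆Y i i∈X =
    subst (λ j → (j ∈ᵇ Y) ≡ true) (toℕ-fromℕ< i<m)
          (∈⇒∈ᵇ (X⊆Y (∈ᵇ⇒∈ (subst (λ j → (j ∈ᵇ X) ≡ true) (sym (toℕ-fromℕ< i<m)) i∈X))))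
    where i<m = ∈ᵇ⇒< X i i∈X

  ⊆ᵇ⇒⊆ : {X Y : Subset m} → (_∈ᵇ X) ⊆ᵇ (_∈ᵇ Y) → X ⊆ Y
  ⊆ᵇ⇒⊆ X⊆Y {x} x∈X = ∈ᵇ⇒∈ (X⊆Y (toℕ x) (∈⇒∈ᵇ x∈X))

  ∣∣≡count : (X : Subset m) → ∣ X ∣ ≡ count (_∈ᵇ X) m
  ∣∣≡count [] = refl
  ∣∣≡count {suc m} (true ∷ X) = trans (cong suc (∣∣≡count X)) (sym (count-shift (_∈ᵇ (true ∷ X)) m))
  ∣∣≡count {suc m} (false ∷ X) = trans (∣∣≡count X) (sym (count-shift (_∈ᵇ (false ∷ X)) m))

  count-∈ᵇ-beyond : ∀ (X : Subset m) j → m ≤ j → count (_∈ᵇ X) j ≡ count (_∈ᵇ X) m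
  count-∈ᵇ-beyond X j m≤j = count-constant (_∈ᵇ X) m≤j (λ i m≤i _ → ∈ᵇ-out X i m≤i)

  count-fromPred : ∀ (g : ℕ → Bool) j → j ≤ m → count (_∈ᵇ fromPred {m} g) j ≡ count g j
  count-fromPred g j j≤m = count-ext j (λ i i<j → ∈ᵇ-fromPred g i (<-≤-trans i<j j≤m))

  ∈ᵇ-∪⁅⁆ : ∀ (X : Subset m) (y : Fin m) j → (j ∈ᵇ X ∪ ⁅ y ⁆) ≡ ((j ∈ᵇ X) ∨ (j ≡ᵇ toℕ y))
  ∈ᵇ-∪⁅⁆ X y j = trans (∈ᵇ-∪ X ⁅ y ⁆ j) (cong ((j ∈ᵇ X) ∨_) (∈ᵇ-⁅⁆ y j))

  ∈ᵇ-─⁅⁆ : ∀ (X : Subset m) (y : Fin m) j → (j ∈ᵇ X ─ ⁅ y ⁆) ≡ ((j ∈ᵇ X) ∧ not (j ≡ᵇ toℕ y))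
  ∈ᵇ-─⁅⁆ X y j = trans (∈ᵇ-─ X ⁅ y ⁆ j) (cong (λ b → (j ∈ᵇ X) ∧ not b) (∈ᵇ-⁅⁆ y j))

  ∉⇒∈ᵇ≡false : {X : Subset m} {x : Fin m} → x ∉ X → (toℕ x ∈ᵇ X) ≡ false
  ∉⇒∈ᵇ≡false {X = X} {x} x∉X with toℕ x ∈ᵇ X in e
  ... | false = refl
  ... | true = ⊥-elim (x∉X (∈ᵇ⇒∈ e))

  does-∈?≡lookup : ∀ (x : Fin m) (S : Subset m) → does (x ∈? S) ≡ lookup S x
  does-∈?≡lookup zero (true ∷ S) = refl
  does-∈?≡lookup zero (false ∷ S) = refl
  does-∈?≡lookup (suc x) (b ∷ S) = does-∈?≡lookup x S

module PathMatroids where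

  open import Data.Nat
  open import Data.Nat.Properties
  open import Data.Nat.Tactic.RingSolver using (solve-∀)
  open import Data.Bool using (Bool; true; false; _∧_; _∨_; not)
  open import Data.Bool.Properties using (∧-comm)
  open import Data.Fin using (Fin; toℕ; fromℕ<)
  open import Data.Fin.Properties using (toℕ<n; toℕ-fromℕ<)
  open import Data.Fin.Subset using (Subset; _∈_; _∉_; ∣_∣; _∪_; _-_; ⁅_⁆; _⊆_; ⊥)
  open import Data.Product using (∃-syntax; _×_; _,_; proj₁; proj₂)
  open import Data.Sum using (inj₁; inj₂)
  open import Data.Empty using (⊥-elim)
  open import Relation.Nullary using (yes; no)
  open import Relation.Binary.PropositionalEquality
  open import Defs using (IsMatroid; Independent; HasRank; IsQuotient)
  open Counting

  record IsPathHeight (m : ℕ) (h : ℕ → ℕ) (c : ℕ) : Set where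
    field
      height-zero : h 0 ≡ 0
      height-step : ∀ j → h (suc j) ≤ suc (h j)
      height-mono : ∀ j → h j ≤ h (suc j)
      height-end : h m ≡ c

  BoundedBasis : ∀ {m} → (ℕ → ℕ) → ℕ → Subset m → Set
  BoundedBasis h c X = (∀ j → count (_∈ᵇ X) j ≤ h j) × ∣ X ∣ ≡ c

  rank-unique : ∀ {m} {B : Subset m → Set} {X r r'} → HasRank B X r → HasRank B X r' → r ≡ r'
  rank-unique ((I , I-ind , I⊆X , ∣I∣) , max) ((I' , I'-ind , I'⊆X , ∣I'∣) , max') =
    ≤-antisym (subst (_≤ _) ∣I∣ (max' I I-ind I⊆X)) (subst (_≤ _) ∣I'∣ (max I' I'-ind I'⊆X))

  module PathMatroid {m : ℕ} {h : ℕ → ℕ} {c : ℕ} (hp : IsPathHeight m h c) where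
    open IsPathHeight hp

    height-monotone : ∀ {j j'} → j ≤ j' → h j ≤ h j'
    height-monotone {j} {zero} z≤n = ≤-refl
    height-monotone {j} {suc j'} j≤ with m≤n⇒m<n∨m≡n j≤
    ... | inj₂ refl = ≤-refl
    ... | inj₁ (s≤s j≤j') = ≤-trans (height-monotone j≤j') (height-mono j')

    end≤height+remaining : ∀ j d → j + d ≡ m → c ≤ h j + d
    end≤height+remaining j zero j+0≡m =
      ≤-reflexive (trans (sym height-end) (trans (cong h (trans (sym j+0≡m) (+-identityʳ j))) (sym (+-identityʳ (h j)))))
    end≤height+remaining j (suc d) j+d≡m =
      ≤-trans (end≤height+remaining (suc j) d (trans (sym (+-suc j d)) j+d≡m))
              (≤-trans (+-monoˡ-≤ d (height-step j)) (≤-reflexive (sym (+-suc (h j) d))))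

    c≤m : c ≤ m
    c≤m = subst (c ≤_) (cong (_+ m) height-zero) (end≤height+remaining 0 m refl)

    independent⇒bounded : ∀ {I : Subset m} → Independent (BoundedBasis h c) I → ∀ j → count (_∈ᵇ I) j ≤ h j
    independent⇒bounded (X , (X-bounded , _) , I⊆X) j = ≤-trans (count-mono j (⊆⇒⊆ᵇ I⊆X)) (X-bounded j)

    -- A bounded set I extends to the basis obtained by adding the first m - c non-elements of I.
    module BasisExtension (I : Subset m) (I-bounded : ∀ j → count (_∈ᵇ I) j ≤ h j) where
      d : ℕ
      d = m ∸ c

      outside : ℕ → Bool
      outside i = not (i ∈ᵇ I)

      basis : Subset m
      basis = fromPred (λ i → not (first d outside i))

      count-basis : ∀ j → j ≤ m → count (_∈ᵇ basis) j + d ⊓ count outside j ≡ j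
      count-basis j j≤m = trans (cong₂ _+_ (count-fromPred _ j j≤m) (sym (count-first d outside j)))
                                (count-not (first d outside) j)

      count-outside : ∀ j → count outside j + count (_∈ᵇ I) j ≡ j
      count-outside = count-not (_∈ᵇ I)

      basis-bounded≤m : ∀ j → j ≤ m → count (_∈ᵇ basis) j ≤ h j
      basis-bounded≤m j j≤m with d ≤? count outside j
      ... | yes d≤ = +-cancelʳ-≤ d _ _ (begin
        count (_∈ᵇ basis) j + d ≡⟨ subst (λ z → count (_∈ᵇ basis) j + z ≡ j) (m≤n⇒m⊓n≡m d≤) (count-basis j j≤m) ⟩
        j                       ≤⟨ j≤d+h ⟩
        d + h j                 ≡⟨ +-comm d (h j) ⟩
        h j + d                 ∎)
        where
        open ≤-Reasoning
        rem : ℕ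
        rem = m ∸ j
        j+rem≡m : j + rem ≡ m
        j+rem≡m = trans (+-comm j rem) (m∸n+n≡m j≤m)
        j≤d+h : j ≤ d + h j
        j≤d+h = +-cancelʳ-≤ rem j (d + h j) (begin
          j + rem         ≡⟨ trans j+rem≡m (sym (m∸n+n≡m c≤m)) ⟩
          d + c           ≤⟨ +-monoʳ-≤ d (end≤height+remaining j rem j+rem≡m) ⟩
          d + (h j + rem) ≡⟨ +-assoc d (h j) rem ⟨
          d + h j + rem   ∎)
      ... | no d≰ = subst (_≤ h j) (sym same) (I-bounded j)
        where
        same : count (_∈ᵇ basis) j ≡ count (_∈ᵇ I) j
        same = +-cancelʳ-≡ (count outside j) _ _
          (trans (subst (λ z → count (_∈ᵇ basis) j + z ≡ j) (m≥n⇒m⊓n≡n (<⇒≤ (≰⇒> d≰))) (count-basis j j≤m))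
                 (trans (sym (count-outside j)) (+-comm (count outside j) _)))

      count-basis-end : count (_∈ᵇ basis) m ≡ c
      count-basis-end = +-cancelʳ-≡ d _ _
        (trans (subst (λ z → count (_∈ᵇ basis) m + z ≡ m) (m≤n⇒m⊓n≡m d≤outside) (count-basis m ≤-refl))
               (trans (sym (m∸n+n≡m c≤m)) (+-comm d c)))
        where
        d≤outside : d ≤ count outside m
        d≤outside = +-cancelʳ-≤ c d (count outside m)
          (subst (_≤ count outside m + c) (sym (m∸n+n≡m c≤m))
            (subst (_≤ count outside m + c) (count-outside m)
              (+-monoʳ-≤ (count outside m) (subst (count (_∈ᵇ I) m ≤_) height-end (I-bounded m)))))

      basis-bounded : ∀ j → count (_∈ᵇ basis) j ≤ h j
      basis-bounded j with j ≤? m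
      ... | yes j≤m = basis-bounded≤m j j≤m
      ... | no j≰m = begin
        count (_∈ᵇ basis) j ≡⟨ count-∈ᵇ-beyond basis j (<⇒≤ (≰⇒> j≰m)) ⟩
        count (_∈ᵇ basis) m ≡⟨ count-basis-end ⟩
        c                   ≡⟨ height-end ⟨
        h m                 ≤⟨ height-monotone (<⇒≤ (≰⇒> j≰m)) ⟩
        h j                 ∎
        where open ≤-Reasoning

      isBasis : BoundedBasis h c basis
      isBasis = basis-bounded , trans (∣∣≡count basis) count-basis-end

      I⊆basis : I ⊆ basis
      I⊆basis = ⊆ᵇ⇒⊆ λ i i∈I → trans (∈ᵇ-fromPred _ i (∈ᵇ⇒< I i i∈I)) (not-first i i∈I)
        where
        not-first : ∀ i → (i ∈ᵇ I) ≡ true → not (first d outside i) ≡ true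
        not-first i i∈I rewrite i∈I = refl

    bounded⇒independent : ∀ {I : Subset m} → (∀ j → count (_∈ᵇ I) j ≤ h j) → Independent (BoundedBasis h c) I
    bounded⇒independent {I} I-bounded = basis , isBasis , I⊆basis
      where open BasisExtension I I-bounded

    independent-bound : ∀ {I X : Subset m} → Independent (BoundedBasis h c) I → I ⊆ X → ∀ s → s ≤ m →
      count (_∈ᵇ I) m + count (_∈ᵇ X) s ≤ h s + count (_∈ᵇ X) m
    independent-bound {I} {X} I-ind I⊆X s s≤m =
      ≤-trans (count-growth (λ i _ _ → ⊆⇒⊆ᵇ I⊆X i) s≤m)
        (≤-trans (+-monoʳ-≤ (count (_∈ᵇ X) m) (independent⇒bounded I-ind s)) (≤-reflexive (+-comm _ (h s))))

    module Greedy (X : Subset m) where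
      greedy : ℕ → ℕ
      greedy zero = 0
      greedy (suc j) = greedy j + bit ((j ∈ᵇ X) ∧ (greedy j <ᵇ h (suc j)))

      kept : ℕ → Bool
      kept j = (j ∈ᵇ X) ∧ (greedy j <ᵇ h (suc j))

      count-kept : ∀ j → count kept j ≡ greedy j
      count-kept zero = refl
      count-kept (suc j) = cong (_+ bit (kept j)) (count-kept j)

      greedy≤height : ∀ j → greedy j ≤ h j
      greedy≤height zero = ≤-reflexive (sym height-zero)
      greedy≤height (suc j) with j ∈ᵇ X
      ... | false = ≤-trans (≤-reflexive (+-identityʳ (greedy j))) (≤-trans (greedy≤height j) (height-mono j))
      ... | true with greedy j <? h (suc j)
      ...   | yes lt rewrite <⇒<ᵇ≡true lt = subst (_≤ h (suc j)) (+-comm 1 (greedy j)) lt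
      ...   | no nlt rewrite ≮⇒<ᵇ≡false nlt =
              ≤-trans (≤-reflexive (+-identityʳ (greedy j))) (≤-trans (greedy≤height j) (height-mono j))

      kept⊆X : kept ⊆ᵇ (_∈ᵇ X)
      kept⊆X i = ∧≡true⇒ˡ

      keptSet : Subset m
      keptSet = fromPred kept

      ∈ᵇ-keptSet : ∀ j → (j ∈ᵇ keptSet) ≡ kept j
      ∈ᵇ-keptSet = ∈ᵇ-fromPred-total kept (λ j m≤j → cong (_∧ (greedy j <ᵇ h (suc j))) (∈ᵇ-out X j m≤j))

      count-keptSet : ∀ j → count (_∈ᵇ keptSet) j ≡ greedy j
      count-keptSet j = trans (count-ext j (λ i _ → ∈ᵇ-keptSet i)) (count-kept j)

      greedy-suc-below : ∀ j → greedy (suc j) < h (suc j) → greedy (suc j) ≡ greedy j + bit (j ∈ᵇ X)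
      greedy-suc-below j lt with j ∈ᵇ X
      ... | false = refl
      ... | true with greedy j <? h (suc j)
      ...   | yes g<h rewrite <⇒<ᵇ≡true g<h = refl
      ...   | no g≮h rewrite ≮⇒<ᵇ≡false g≮h = ⊥-elim (g≮h (≤-<-trans (m≤m+n (greedy j) 0) lt))

      -- s is the last point where the greedy count touches the boundary; after s it keeps every element.
      tight : ∀ j → ∃[ s ] (s ≤ j × greedy j + count (_∈ᵇ X) s ≡ h s + count (_∈ᵇ X) j ×
                            (∀ i → s < i → i ≤ j → greedy i < h i))
      tight zero = 0 , z≤n , cong (_+ 0) (sym height-zero) , λ i s<i i≤0 → ⊥-elim (<⇒≱ s<i i≤0)
      tight (suc j) with greedy (suc j) ≟ h (suc j)
      ... | yes touches = suc j , ≤-refl , cong (_+ count (_∈ᵇ X) (suc j)) touches , λ i s<i i≤s → ⊥-elim (<⇒≱ s<i i≤s)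
      ... | no g≢h with tight j
      ...   | s , s≤j , balance , below = s , m≤n⇒m≤1+n s≤j , balance′ , below′
        where
        lt : greedy (suc j) < h (suc j)
        lt = ≤∧≢⇒< (greedy≤height (suc j)) g≢h
        swap : ∀ a b c → a + b + c ≡ a + c + b
        swap = solve-∀
        balance′ : greedy (suc j) + count (_∈ᵇ X) s ≡ h s + count (_∈ᵇ X) (suc j)
        balance′ = trans (cong (_+ count (_∈ᵇ X) s) (greedy-suc-below j lt))
          (trans (swap (greedy j) (bit (j ∈ᵇ X)) (count (_∈ᵇ X) s))
            (trans (cong (_+ bit (j ∈ᵇ X)) balance) (+-assoc (h s) (count (_∈ᵇ X) j) _)))
        below′ : ∀ i → s < i → i ≤ suc j → greedy i < h i
        below′ i s<i i≤1+j with m≤n⇒m<n∨m≡n i≤1+j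
        ... | inj₁ (s≤s i≤j) = below i s<i i≤j
        ... | inj₂ refl = lt

      keptSet-independent : Independent (BoundedBasis h c) keptSet
      keptSet-independent = bounded⇒independent (λ j → subst (_≤ h j) (sym (count-keptSet j)) (greedy≤height j))

      keptSet⊆X : keptSet ⊆ X
      keptSet⊆X = ⊆ᵇ⇒⊆ (λ i i∈ → kept⊆X i (trans (sym (∈ᵇ-keptSet i)) i∈))

      greedy-bound : ∀ s → s ≤ m → greedy m + count (_∈ᵇ X) s ≤ h s + count (_∈ᵇ X) m
      greedy-bound s s≤m = subst (λ z → z + count (_∈ᵇ X) s ≤ h s + count (_∈ᵇ X) m) (count-keptSet m)
                             (independent-bound keptSet-independent keptSet⊆X s s≤m)

      rank : HasRank (BoundedBasis h c) X (greedy m)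
      rank = (keptSet , keptSet-independent , keptSet⊆X , trans (∣∣≡count keptSet) (count-keptSet m)) ,
             maximal
        where
        maximal : ∀ I → Independent (BoundedBasis h c) I → I ⊆ X → ∣ I ∣ ≤ greedy m
        maximal I I-ind I⊆X with tight m
        ... | s , s≤m , balance , _ =
          subst (_≤ greedy m) (sym (∣∣≡count I))
            (+-cancelʳ-≤ (count (_∈ᵇ X) s) _ _
              (subst (count (_∈ᵇ I) m + count (_∈ᵇ X) s ≤_) (sym balance) (independent-bound I-ind I⊆X s s≤m)))

    -- The exchanged element y is the last element of Y ∖ X.  To the right of y, Y ⊆ X, so between
    -- y and x the set Y is strictly ahead of X and leaves room for the extra element.
    module Exchange (X Y : Subset m) (X-basis : BoundedBasis h c X) (Y-basis : BoundedBasis h c Y)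
                    (x : Fin m) (x∈X : x ∈ X) (x∉Y : x ∉ Y) where
      private
        x0 : ℕ
        x0 = toℕ x
        x0<m : x0 < m
        x0<m = toℕ<n x
        x0∈X : (x0 ∈ᵇ X) ≡ true
        x0∈X = ∈⇒∈ᵇ x∈X
        x0∉Y : (x0 ∈ᵇ Y) ≡ false
        x0∉Y = ∉⇒∈ᵇ≡false x∉Y
        X∖Y Y∖X : ℕ → Bool
        X∖Y i = (i ∈ᵇ X) ∧ not (i ∈ᵇ Y)
        Y∖X i = (i ∈ᵇ Y) ∧ not (i ∈ᵇ X)

      ∣X∣≡∣Y∣ : count (_∈ᵇ X) m ≡ count (_∈ᵇ Y) m
      ∣X∣≡∣Y∣ = trans (sym (∣∣≡count X)) (trans (proj₂ X-basis) (trans (sym (proj₂ Y-basis)) (∣∣≡count Y)))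

      ∣X∖Y∣≡∣Y∖X∣ : count X∖Y m ≡ count Y∖X m
      ∣X∖Y∣≡∣Y∖X∣ = +-cancelˡ-≡ (count (λ i → (i ∈ᵇ X) ∧ (i ∈ᵇ Y)) m) _ _ (begin
        count (λ i → (i ∈ᵇ X) ∧ (i ∈ᵇ Y)) m + count X∖Y m ≡⟨ count-split (_∈ᵇ X) (_∈ᵇ Y) m ⟨
        count (_∈ᵇ X) m                                    ≡⟨ ∣X∣≡∣Y∣ ⟩
        count (_∈ᵇ Y) m                                    ≡⟨ count-split (_∈ᵇ Y) (_∈ᵇ X) m ⟩
        count (λ i → (i ∈ᵇ Y) ∧ (i ∈ᵇ X)) m + count Y∖X m ≡⟨ cong (_+ count Y∖X m) (count-ext m (λ i _ → ∧-comm (i ∈ᵇ Y) (i ∈ᵇ X))) ⟩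
        count (λ i → (i ∈ᵇ X) ∧ (i ∈ᵇ Y)) m + count Y∖X m ∎)
        where open ≡-Reasoning

      private
        lastY∖X : ∃[ i ] (i < m × Y∖X i ≡ true × (∀ i' → i < i' → i' < m → Y∖X i' ≡ false))
        lastY∖X = count-pos⇒last Y∖X m (subst (0 <_) ∣X∖Y∣≡∣Y∖X∣ (count-pos X∖Y x0 m x0<m (∧≡true x0∈X (not≡true x0∉Y))))
        y0 : ℕ
        y0 = proj₁ lastY∖X
        y0<m : y0 < m
        y0<m = proj₁ (proj₂ lastY∖X)
        y0∈Y∖X : Y∖X y0 ≡ true
        y0∈Y∖X = proj₁ (proj₂ (proj₂ lastY∖X))
        y0∉X : (y0 ∈ᵇ X) ≡ false
        y0∉X = not≡true⇒ (∧≡true⇒ʳ {y0 ∈ᵇ Y} y0∈Y∖X)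

      Y⊆X-right-of-y : ∀ i → y0 < i → i < m → (i ∈ᵇ Y) ≡ true → (i ∈ᵇ X) ≡ true
      Y⊆X-right-of-y i y0<i i<m i∈Y with i ∈ᵇ X in i∈X
      ... | true = refl
      ... | false = ⊥-elim (false≢true (trans (sym (proj₂ (proj₂ (proj₂ lastY∖X)) i y0<i i<m)) (∧≡true i∈Y (not≡true i∈X))))

      y : Fin m
      y = fromℕ< y0<m

      private
        toℕy : toℕ y ≡ y0
        toℕy = toℕ-fromℕ< y0<m

      y∈Y : y ∈ Y
      y∈Y = ∈ᵇ⇒∈ (trans (cong (_∈ᵇ Y) toℕy) (∧≡true⇒ˡ y0∈Y∖X))

      y∉X : y ∉ X
      y∉X y∈X = false≢true (trans (sym y0∉X) (trans (cong (_∈ᵇ X) (sym toℕy)) (∈⇒∈ᵇ y∈X)))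

      private
        X-x : ℕ → Bool
        X-x i = (i ∈ᵇ X) ∧ not (i ≡ᵇ x0)
        X-x∌y0 : X-x y0 ≡ false
        X-x∌y0 rewrite y0∉X = refl

      count-Z : ∀ j → count (_∈ᵇ (X - x) ∪ ⁅ y ⁆) j ≡ count (λ i → X-x i ∨ (i ≡ᵇ y0)) j
      count-Z j = count-ext j (λ i _ → trans (∈ᵇ-∪⁅⁆ (X - x) y i) (cong₂ _∨_ (∈ᵇ-─⁅⁆ X x i) (cong (i ≡ᵇ_) toℕy)))

      ∣Z∣ : ∣ (X - x) ∪ ⁅ y ⁆ ∣ ≡ c
      ∣Z∣ = trans (∣∣≡count ((X - x) ∪ ⁅ y ⁆)) (trans (count-Z m) (trans (count-insert-> X-x y0 X-x∌y0 m y0<m)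
              (trans (count-remove-> (_∈ᵇ X) x0 x0∈X m x0<m) (trans (sym (∣∣≡count X)) (proj₂ X-basis)))))

      between : ∀ j → y0 < j → j ≤ x0 → suc (count X-x j) ≤ h j
      between j y0<j j≤x0 = begin
        suc (count X-x j)          ≡⟨ cong suc (count-remove-≤ (_∈ᵇ X) x0 x0∈X j j≤x0) ⟩
        suc (count (_∈ᵇ X) j)      ≤⟨ +-cancelˡ-≤ (count (_∈ᵇ Y) m) _ _
                                        (subst₂ _≤_ (sym (+-suc _ _)) (cong (_+ count (_∈ᵇ Y) j) ∣X∣≡∣Y∣) X-gains-more) ⟩
        count (_∈ᵇ Y) j            ≤⟨ proj₁ Y-basis j ⟩
        h j                        ∎
        where
        open ≤-Reasoning
        X-gains-more : suc (count (_∈ᵇ Y) m + count (_∈ᵇ X) j) ≤ count (_∈ᵇ X) m + count (_∈ᵇ Y) j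
        X-gains-more = count-growth-strict (λ i j≤i i<m → Y⊆X-right-of-y i (<-≤-trans y0<j j≤i) i<m) j≤x0 x0<m x0∉Y x0∈X

      Z-bounded : ∀ j → count (_∈ᵇ (X - x) ∪ ⁅ y ⁆) j ≤ h j
      Z-bounded j rewrite count-Z j with j ≤? y0
      ... | yes j≤y0 = subst (_≤ h j) (sym (count-insert-≤ X-x y0 X-x∌y0 j j≤y0))
                         (≤-trans (count-mono j (λ i → ∧≡true⇒ˡ)) (proj₁ X-basis j))
      ... | no j≰y0 with j ≤? x0
      ...   | yes j≤x0 = subst (_≤ h j) (sym (count-insert-> X-x y0 X-x∌y0 j (≰⇒> j≰y0))) (between j (≰⇒> j≰y0) j≤x0)
      ...   | no j≰x0 = subst (_≤ h j) (sym (trans (count-insert-> X-x y0 X-x∌y0 j (≰⇒> j≰y0))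
                                               (count-remove-> (_∈ᵇ X) x0 x0∈X j (≰⇒> j≰x0))))
                          (proj₁ X-basis j)

    exchange : ∀ (X Y : Subset m) → BoundedBasis h c X → BoundedBasis h c Y → ∀ x → x ∈ X → x ∉ Y →
      ∃[ y ] (y ∈ Y × y ∉ X × BoundedBasis h c ((X - x) ∪ ⁅ y ⁆))
    exchange X Y X-basis Y-basis x x∈X x∉Y = y , y∈Y , y∉X , Z-bounded , ∣Z∣
      where open Exchange X Y X-basis Y-basis x x∈X x∉Y

    isMatroid : IsMatroid (BoundedBasis {m} h c)
    isMatroid = (basis , isBasis) , exchange
      where
      open BasisExtension ⊥ (λ j → subst (_≤ h j) (sym (trans (count-ext j (λ i _ → ∈ᵇ-⊥ {m} i)) (count-false j))) z≤n)

    module _ (F : Subset m) (e : Fin m) (e∉F : e ∉ F) where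
      private
        e0 : ℕ
        e0 = toℕ e
        e0∉F : (e0 ∈ᵇ F) ≡ false
        e0∉F = ∉⇒∈ᵇ≡false e∉F
        count-F+e : ∀ j → count (_∈ᵇ F ∪ ⁅ e ⁆) j ≡ count (λ i → (i ∈ᵇ F) ∨ (i ≡ᵇ e0)) j
        count-F+e j = count-ext j (λ i _ → ∈ᵇ-∪⁅⁆ F e i)
        count-F+e-> : ∀ j → e0 < j → count (_∈ᵇ F ∪ ⁅ e ⁆) j ≡ suc (count (_∈ᵇ F) j)
        count-F+e-> j e0<j = trans (count-F+e j) (count-insert-> (_∈ᵇ F) e0 e0∉F j e0<j)
        open Greedy F

      -- The kept set of F together with e stays below h.
      insert-increases-rank : (∀ i → e0 < i → i ≤ m → greedy i < h i) →
        ∀ {r} → HasRank (BoundedBasis h c) (F ∪ ⁅ e ⁆) r → greedy m < r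
      insert-increases-rank slack (_ , maximal) = subst (_≤ _) (sym ∣I∣) (maximal I I-independent I⊆F+e)
        where
        kept+e : ℕ → Bool
        kept+e i = kept i ∨ (i ≡ᵇ e0)
        kept∌e0 : kept e0 ≡ false
        kept∌e0 = cong (_∧ (greedy e0 <ᵇ h (suc e0))) e0∉F
        I : Subset m
        I = fromPred kept+e
        count-I : ∀ j → j ≤ m → count (_∈ᵇ I) j ≡ count kept+e j
        count-I j j≤m = count-fromPred kept+e j j≤m
        I-bounded≤m : ∀ j → j ≤ m → count (_∈ᵇ I) j ≤ h j
        I-bounded≤m j j≤m with j ≤? e0
        ... | yes j≤e0 = subst (_≤ h j) (sym (trans (count-I j j≤m) (trans (count-insert-≤ kept e0 kept∌e0 j j≤e0) (count-kept j))))
                           (greedy≤height j)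
        ... | no j≰e0 = subst (_≤ h j) (sym (trans (count-I j j≤m) (trans (count-insert-> kept e0 kept∌e0 j (≰⇒> j≰e0)) (cong suc (count-kept j)))))
                          (slack j (≰⇒> j≰e0) j≤m)
        I-bounded : ∀ j → count (_∈ᵇ I) j ≤ h j
        I-bounded j with j ≤? m
        ... | yes j≤m = I-bounded≤m j j≤m
        ... | no j≰m = subst (_≤ h j) (sym (count-∈ᵇ-beyond I j (<⇒≤ (≰⇒> j≰m))))
                         (≤-trans (I-bounded≤m m ≤-refl) (height-monotone (<⇒≤ (≰⇒> j≰m))))
        I-independent : Independent (BoundedBasis h c) I
        I-independent = bounded⇒independent I-bounded
        I⊆F+e : I ⊆ F ∪ ⁅ e ⁆
        I⊆F+e = ⊆ᵇ⇒⊆ λ i i∈I → trans (∈ᵇ-∪⁅⁆ F e i) (kept+e⊆F+e i (trans (sym (∈ᵇ-fromPred kept+e i (∈ᵇ⇒< I i i∈I))) i∈I))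
          where
          kept+e⊆F+e : ∀ i → kept+e i ≡ true → ((i ∈ᵇ F) ∨ (i ≡ᵇ e0)) ≡ true
          kept+e⊆F+e i k with ∨≡true⇒ {kept i} k
          ... | inj₁ i-kept = ∨≡trueˡ _ (kept⊆X i i-kept)
          ... | inj₂ i≡e0 = ∨≡trueʳ (i ∈ᵇ F) i≡e0
        ∣I∣ : suc (greedy m) ≡ ∣ I ∣
        ∣I∣ = trans (cong suc (sym (count-kept m)))
                (sym (trans (∣∣≡count I) (trans (count-I m ≤-refl) (count-insert-> kept e0 kept∌e0 m (toℕ<n e)))))

      insert-keeps-rank : ∀ j → e0 < j → j ≤ m → h j + count (_∈ᵇ F) m ≤ greedy m + count (_∈ᵇ F) j →
        ∀ {r} → HasRank (BoundedBasis h c) (F ∪ ⁅ e ⁆) r → r ≤ greedy m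
      insert-keeps-rank j e0<j j≤m F-tight ((I , I-independent , I⊆F+e , ∣I∣) , _) =
        +-cancelʳ-≤ (count (_∈ᵇ F) j) _ _ (≤-trans (≤-pred I-bound) F-tight)
        where
        I-bound : suc (_ + count (_∈ᵇ F) j) ≤ suc (h j + count (_∈ᵇ F) m)
        I-bound = subst₂ _≤_
          (trans (cong₂ _+_ (trans (sym (∣∣≡count I)) ∣I∣) (count-F+e-> j e0<j)) (+-suc _ _))
          (trans (cong (h j +_) (count-F+e-> m (toℕ<n e))) (+-suc (h j) _))
          (independent-bound I-independent I⊆F+e j j≤m)

  slack-transfer : ∀ {r' Fs0 h's0 F hs' h's' hs0 Fs' r0} →
    r' + Fs0 ≤ h's0 + F → h's0 + hs' ≤ h's' + hs0 → r' + Fs' ≡ h's' + F → r0 + Fs0 ≡ hs0 + F →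
    hs' + F ≤ r0 + Fs'
  slack-transfer {r'} {Fs0} {h's0} {F} {hs'} {h's'} {hs0} {Fs'} {r0} le₁ le₂ eq₁ eq₂ =
    +-cancelˡ-≤ (r' + Fs0 + h's0) _ _ (begin
      r' + Fs0 + h's0 + (hs' + F)                 ≡⟨ shuffle₁ r' Fs0 h's0 hs' F ⟩
      (r' + Fs0) + (h's0 + hs') + F               ≤⟨ +-monoˡ-≤ F (+-mono-≤ le₁ le₂) ⟩
      (h's0 + F) + (h's' + hs0) + F               ≡⟨ shuffle₂ h's0 F h's' hs0 ⟩
      h's0 + (h's' + F) + (hs0 + F)               ≡⟨ cong₂ (λ u v → h's0 + u + v) eq₁ eq₂ ⟨
      h's0 + (r' + Fs') + (r0 + Fs0)              ≡⟨ shuffle₃ h's0 r' Fs' r0 Fs0 ⟩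
      r' + Fs0 + h's0 + (r0 + Fs')                ∎)
    where
    open ≤-Reasoning
    shuffle₁ : ∀ a b c d e → a + b + c + (d + e) ≡ (a + b) + (c + d) + e
    shuffle₁ = solve-∀
    shuffle₂ : ∀ a b c d → (a + b) + (c + d) + b ≡ a + (c + b) + (d + b)
    shuffle₂ = solve-∀
    shuffle₃ : ∀ a b c d e → a + (b + c) + (d + e) ≡ b + e + a + (d + c)
    shuffle₃ = solve-∀

  -- slack-mono says that h' - h is nondecreasing, stated without subtraction.
  module Quotient {m h c h' c'} (hp : IsPathHeight m h c) (hp' : IsPathHeight m h' c')
    (slack-mono : ∀ {j j'} → j ≤ j' → h' j + h j' ≤ h' j' + h j) where
    private
      module M = PathMatroid hp
      module M' = PathMatroid hp'

    -- The witness is the h-tight point s0 of F, or s' when s0 < s' (then slack-mono applies).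
    tight-after : ∀ F (e : Fin m) {s'} → s' ≤ m → toℕ e < s' →
      M'.Greedy.greedy F m + count (_∈ᵇ F) s' ≡ h' s' + count (_∈ᵇ F) m →
      ∃[ j ] (toℕ e < j × j ≤ m × h j + count (_∈ᵇ F) m ≤ M.Greedy.greedy F m + count (_∈ᵇ F) j)
    tight-after F e {s'} s'≤m e<s' balance' with M.Greedy.tight F m
    ... | s0 , s0≤m , balance0 , _ with s' ≤? s0
    ...   | yes s'≤s0 = s0 , <-≤-trans e<s' s'≤s0 , s0≤m , ≤-reflexive (sym balance0)
    ...   | no s'≰s0 = s' , e<s' , s'≤m ,
              slack-transfer {M'.Greedy.greedy F m} {count (_∈ᵇ F) s0} {h' s0} {count (_∈ᵇ F) m}
                             {h s'} {h' s'} {h s0} {count (_∈ᵇ F) s'} {M.Greedy.greedy F m}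
                             (M'.Greedy.greedy-bound F s0 s0≤m) (slack-mono (<⇒≤ (≰⇒> s'≰s0))) balance' balance0

    isQuotient : IsQuotient (BoundedBasis {m} h c) (BoundedBasis {m} h' c')
    isQuotient F F-flat e e∉F r' r'' r'-rank r''-rank with M'.Greedy.tight F m
    ... | s' , s'≤m , balance' , below' with s' ≤? toℕ e
    ...   | yes s'≤e = subst (_< r'') (sym (rank-unique r'-rank (M'.Greedy.rank F)))
                         (M'.insert-increases-rank F e e∉F (λ i e<i i≤m → below' i (≤-<-trans s'≤e e<i) i≤m) r''-rank)
    ...   | no s'≰e with tight-after F e s'≤m (≰⇒> s'≰e) balance'
    ...     | j , e<j , j≤m , F-tight =
              ⊥-elim (<⇒≱ (F-flat e e∉F _ _ (M.Greedy.rank F) (M.Greedy.rank (F ∪ ⁅ e ⁆)))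
                          (M.insert-keeps-rank F e e∉F j e<j j≤m F-tight (M.Greedy.rank (F ∪ ⁅ e ⁆))))

module LatticePaths where

  open import Data.Nat
  open import Data.Nat.Properties
  open import Algebra.Properties.CommutativeSemigroup +-commutativeSemigroup using (interchange)
  open import Data.Bool using (true; false; if_then_else_)
  open import Data.List as List using (List; length) renaming ([] to []ₗ; _∷_ to _∷ₗ_; _++_ to _++ₗ_)
  open import Data.List.Relation.Binary.Pointwise using (Pointwise; []; _∷_; ++⁺)
  open import Data.Fin.Subset using (Subset)
  open import Data.Vec as Vec using (Vec; []; _∷_; toList; replicate; _++_)
  open import Data.Vec.Properties using (toList-++; length-toList)
  open import Data.Product using (∃-syntax; _×_; _,_)
  open import Data.Sum using (inj₁; inj₂)
  open import Relation.Nullary using (yes; no)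
  open import Relation.Binary.PropositionalEquality
  open import Defs
  open Counting
  open PathMatroids

  stepHeight : Step → ℕ
  stepHeight s = if isN s then 1 else 0

  stepHeight≡bit : ∀ s → stepHeight s ≡ bit (isN s)
  stepHeight≡bit E = refl
  stepHeight≡bit N = refl

  heightAt-step : ∀ w j → heightAt (suc j) w ≤ suc (heightAt j w)
  heightAt-step []ₗ j = z≤n
  heightAt-step (E ∷ₗ w) zero = z≤n
  heightAt-step (N ∷ₗ w) zero = ≤-refl
  heightAt-step (E ∷ₗ w) (suc j) = heightAt-step w j
  heightAt-step (N ∷ₗ w) (suc j) = s≤s (heightAt-step w j)

  heightAt-mono : ∀ w j → heightAt j w ≤ heightAt (suc j) w
  heightAt-mono []ₗ zero = z≤n
  heightAt-mono []ₗ (suc j) = z≤n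
  heightAt-mono (s ∷ₗ w) zero = z≤n
  heightAt-mono (E ∷ₗ w) (suc j) = heightAt-mono w j
  heightAt-mono (N ∷ₗ w) (suc j) = s≤s (heightAt-mono w j)

  heightAt-end : ∀ w j → length w ≤ j → heightAt j w ≡ countN w
  heightAt-end []ₗ zero _ = refl
  heightAt-end []ₗ (suc j) _ = refl
  heightAt-end (s ∷ₗ w) (suc j) (s≤s len≤j) = cong (stepHeight s +_) (heightAt-end w j len≤j)

  heightAt-++ʳ : ∀ u v j → heightAt (length u + j) (u ++ₗ v) ≡ countN u + heightAt j v
  heightAt-++ʳ []ₗ v j = refl
  heightAt-++ʳ (s ∷ₗ u) v j = trans (cong (stepHeight s +_) (heightAt-++ʳ u v j)) (sym (+-assoc (stepHeight s) _ _))

  heightAt-++ˡ : ∀ u v j → j ≤ length u → heightAt j (u ++ₗ v) ≡ heightAt j u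
  heightAt-++ˡ u v zero _ = refl
  heightAt-++ˡ (s ∷ₗ u) v (suc j) (s≤s j≤len) = cong (stepHeight s +_) (heightAt-++ˡ u v j j≤len)

  countN-++ : ∀ u v → countN (u ++ₗ v) ≡ countN u + countN v
  countN-++ []ₗ v = refl
  countN-++ (s ∷ₗ u) v = trans (cong (stepHeight s +_) (countN-++ u v)) (sym (+-assoc (stepHeight s) _ _))

  heightAt≡count-stepsN : ∀ {m} (Q : Vec Step m) j → heightAt j (toList Q) ≡ count (_∈ᵇ stepsN Q) j
  heightAt≡count-stepsN Q zero = refl
  heightAt≡count-stepsN [] (suc j) = sym (count-false (suc j))
  heightAt≡count-stepsN (s ∷ Q) (suc j) =
    trans (cong₂ _+_ (stepHeight≡bit s) (heightAt≡count-stepsN Q j)) (sym (count-shift (_∈ᵇ stepsN (s ∷ Q)) j))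

  pathOf : ∀ {m} → Subset m → Vec Step m
  pathOf = Vec.map (λ b → if b then N else E)

  stepsN-pathOf : ∀ {m} (B : Subset m) → stepsN (pathOf B) ≡ B
  stepsN-pathOf [] = refl
  stepsN-pathOf (true ∷ B) = cong (true ∷_) (stepsN-pathOf B)
  stepsN-pathOf (false ∷ B) = cong (false ∷_) (stepsN-pathOf B)

  module _ {m : ℕ} (P : Vec Step m) where

    heightOf : ℕ → ℕ
    heightOf j = heightAt j (toList P)

    nested⇒bounded : ∀ B → NestedBasis P B → BoundedBasis heightOf (countN (toList P)) B
    nested⇒bounded B (Q , Q-end , Q-below , refl) =
      (λ j → subst (_≤ heightOf j) (heightAt≡count-stepsN Q j) (Q-below j)) ,
      trans (∣∣≡count B) (trans (sym (heightAt≡count-stepsN Q m))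
        (trans (heightAt-end (toList Q) m (≤-reflexive (length-toList Q))) Q-end))

    bounded⇒nested : ∀ B → BoundedBasis heightOf (countN (toList P)) B → NestedBasis P B
    bounded⇒nested B (B-bounded , ∣B∣) = pathOf B , Q-end , Q-below , stepsN-pathOf B
      where
      Q : Vec Step m
      Q = pathOf B
      height-Q : ∀ j → heightAt j (toList Q) ≡ count (_∈ᵇ B) j
      height-Q j = trans (heightAt≡count-stepsN Q j) (cong (λ Z → count (_∈ᵇ Z) j) (stepsN-pathOf B))
      Q-end : countN (toList Q) ≡ countN (toList P)
      Q-end = trans (sym (heightAt-end (toList Q) m (≤-reflexive (length-toList Q))))
                    (trans (height-Q m) (trans (sym (∣∣≡count B)) ∣B∣))
      Q-below : Below Q P
      Q-below j = subst (_≤ heightOf j) (sym (height-Q j)) (B-bounded j)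

  data _≼_ : Step → Step → Set where
    E≼ : ∀ {s} → E ≼ s
    N≼N : N ≼ N

  stepHeight-≼ : ∀ {s s'} → s ≼ s' → stepHeight s ≤ stepHeight s'
  stepHeight-≼ E≼ = z≤n
  stepHeight-≼ N≼N = ≤-refl

  heightAt-≼ : ∀ {u u'} → Pointwise _≼_ u u' → ∀ j → heightAt j u ≤ heightAt j u'
  heightAt-≼ _ zero = z≤n
  heightAt-≼ [] (suc j) = z≤n
  heightAt-≼ (s≼s' ∷ u≼u') (suc j) = +-mono-≤ (stepHeight-≼ s≼s') (heightAt-≼ u≼u' j)

  heightAt-slack-mono : ∀ {u u'} → Pointwise _≼_ u u' → ∀ {j j'} → j ≤ j' →
    heightAt j u' + heightAt j' u ≤ heightAt j' u' + heightAt j u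
  heightAt-slack-mono u≼u' {zero} {j'} _ = subst (_≤ _) (sym (+-identityˡ _)) (≤-trans (heightAt-≼ u≼u' j') (m≤m+n _ 0))
  heightAt-slack-mono [] {suc j} {suc j'} _ = ≤-refl
  heightAt-slack-mono (_∷_ {s} {s'} {u} {u'} s≼s' u≼u') {suc j} {suc j'} (s≤s j≤j') =
    subst₂ _≤_ (interchange (stepHeight s') (stepHeight s) (heightAt j u') (heightAt j' u))
               (interchange (stepHeight s') (stepHeight s) (heightAt j' u') (heightAt j u))
               (+-monoʳ-≤ (stepHeight s' + stepHeight s) (heightAt-slack-mono u≼u' j≤j'))

  block : ℕ → ℕ → List Step
  block a b = toList (replicate a N ++ replicate b E)

  tbpWord : ℕ → ℕ → ℕ → List Step
  tbpWord a b n = toList (tbpPath a b n)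

  tbpWord-suc : ∀ a b n → tbpWord a b (suc n) ≡ block a b ++ₗ tbpWord a b n
  tbpWord-suc a b n = toList-++ (replicate a N ++ replicate b E) (tbpPath a b n)

  length-block : ∀ a b → length (block a b) ≡ a + b
  length-block a b = length-toList (replicate a N ++ replicate b E)

  heightAt-Eʳ : ∀ b r → heightAt r (toList (replicate b E)) ≡ 0
  heightAt-Eʳ zero zero = refl
  heightAt-Eʳ zero (suc r) = refl
  heightAt-Eʳ (suc b) zero = refl
  heightAt-Eʳ (suc b) (suc r) = heightAt-Eʳ b r

  heightAt-block : ∀ a b r → heightAt r (block a b) ≡ r ⊓ a
  heightAt-block zero b r = trans (heightAt-Eʳ b r) (sym (⊓-zeroʳ r))
  heightAt-block (suc a) b zero = refl
  heightAt-block (suc a) b (suc r) = cong suc (heightAt-block a b r)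

  countN-block : ∀ a b → countN (block a b) ≡ a
  countN-block a b = trans (sym (heightAt-end (block a b) (a + b) (≤-reflexive (length-block a b))))
                           (trans (heightAt-block a b (a + b)) (m≥n⇒m⊓n≡n (m≤m+n a b)))

  countN-tbpWord : ∀ a b n → countN (tbpWord a b n) ≡ n * a
  countN-tbpWord a b zero = refl
  countN-tbpWord a b (suc n) = trans (cong countN (tbpWord-suc a b n))
    (trans (countN-++ (block a b) (tbpWord a b n)) (cong₂ _+_ (countN-block a b) (countN-tbpWord a b n)))

  heightAt-tbpWord : ∀ a b n t r → t < n → r ≤ a + b →
    heightAt (t * (a + b) + r) (tbpWord a b n) ≡ t * a + r ⊓ a
  heightAt-tbpWord a b (suc n) zero r _ r≤a+b = begin
    heightAt r (tbpWord a b (suc n))         ≡⟨ cong (heightAt r) (tbpWord-suc a b n) ⟩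
    heightAt r (block a b ++ₗ tbpWord a b n) ≡⟨ heightAt-++ˡ (block a b) _ r (subst (r ≤_) (sym (length-block a b)) r≤a+b) ⟩
    heightAt r (block a b)                   ≡⟨ heightAt-block a b r ⟩
    r ⊓ a                                    ∎
    where open ≡-Reasoning
  heightAt-tbpWord a b (suc n) (suc t) r (s≤s t<n) r≤a+b = begin
    heightAt (suc t * (a + b) + r) (tbpWord a b (suc n))
      ≡⟨ cong₂ heightAt (trans (+-assoc (a + b) (t * (a + b)) r) (cong (_+ (t * (a + b) + r)) (sym (length-block a b))))
                        (tbpWord-suc a b n) ⟩
    heightAt (length (block a b) + (t * (a + b) + r)) (block a b ++ₗ tbpWord a b n)
      ≡⟨ heightAt-++ʳ (block a b) (tbpWord a b n) (t * (a + b) + r) ⟩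
    countN (block a b) + heightAt (t * (a + b) + r) (tbpWord a b n)
      ≡⟨ cong₂ _+_ (countN-block a b) (heightAt-tbpWord a b n t r t<n r≤a+b) ⟩
    a + (t * a + r ⊓ a)
      ≡⟨ +-assoc a (t * a) (r ⊓ a) ⟨
    suc t * a + r ⊓ a ∎
    where open ≡-Reasoning

  heightAt-tbpWord-end : ∀ a b n j → n * (a + b) ≤ j → heightAt j (tbpWord a b n) ≡ n * a
  heightAt-tbpWord-end a b n j n[a+b]≤j =
    trans (heightAt-end (tbpWord a b n) j (subst (_≤ j) (sym (length-toList (tbpPath a b n))) n[a+b]≤j))
          (countN-tbpWord a b n)

  tbpWord-≼ : ∀ a b a' b' n → a ≤ a' → a + b ≡ a' + b' → Pointwise _≼_ (tbpWord a b n) (tbpWord a' b' n)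
  tbpWord-≼ a b a' b' zero _ _ = []
  tbpWord-≼ a b a' b' (suc n) a≤a' same-length =
    subst₂ (Pointwise _≼_) (sym (tbpWord-suc a b n)) (sym (tbpWord-suc a' b' n))
      (++⁺ (block-≼ a b a' b' a≤a' same-length) (tbpWord-≼ a b a' b' n a≤a' same-length))
    where
    E*-≼ : ∀ b w → length w ≡ b → Pointwise _≼_ (toList (replicate b E)) w
    E*-≼ zero []ₗ _ = []
    E*-≼ (suc b) (s ∷ₗ w) len = E≼ ∷ E*-≼ b w (suc-injective len)
    block-≼ : ∀ a b a' b' → a ≤ a' → a + b ≡ a' + b' → Pointwise _≼_ (block a b) (block a' b')
    block-≼ zero b a' b' _ same = E*-≼ b (block a' b') (trans (length-block a' b') (sym same))
    block-≼ (suc a) b (suc a') b' (s≤s a≤a') same = N≼N ∷ block-≼ a b a' b' a≤a' (suc-injective same)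

  Checkpoints : ∀ {M} → ℕ → ℕ → ℕ → Subset M → Set
  Checkpoints a L n X = (∀ t → t ≤ n → count (_∈ᵇ X) (t * L) ≤ t * a) × count (_∈ᵇ X) (n * L) ≡ n * a

  divMod-< : ∀ L n j → j < n * L → ∃[ t ] ∃[ r ] (t < n × r ≤ L × t * L + r ≡ j)
  divMod-< L (suc n) j j<L+nL with j <? L
  ... | yes j<L = 0 , j , s≤s z≤n , <⇒≤ j<L , refl
  ... | no j≮L with m≤n⇒∃[o]m+o≡n (≮⇒≥ j≮L)
  ...   | j' , L+j'≡j with divMod-< L n j' (+-cancelˡ-< L j' (n * L) (subst (_< L + n * L) (sym L+j'≡j) j<L+nL))
  ...     | t , r , t<n , r≤L , tL+r≡j' =
            suc t , r , s≤s t<n , r≤L , trans (+-assoc L (t * L) r) (trans (cong (L +_) tL+r≡j') L+j'≡j)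

  module _ (a b n : ℕ) {M : ℕ} (M≡ : M ≡ n * (a + b)) where
    private
      L : ℕ
      L = a + b
      h : ℕ → ℕ
      h j = heightAt j (tbpWord a b n)

    -- Between checkpoints the path first rises, then runs flat, so a bound at both ends suffices.
    checkpoints⇒bounded : ∀ (X : Subset M) → Checkpoints a L n X → BoundedBasis h (n * a) X
    checkpoints⇒bounded X (at-checkpoints , total) = bounded , trans (∣∣≡count X) (trans (cong (count (_∈ᵇ X)) M≡) total)
      where
      bounded : ∀ j → count (_∈ᵇ X) j ≤ h j
      bounded j with j <? n * L
      ... | no j≮nL = ≤-reflexive (begin
        count (_∈ᵇ X) j ≡⟨ count-∈ᵇ-beyond X j (subst (_≤ j) (sym M≡) (≮⇒≥ j≮nL)) ⟩
        count (_∈ᵇ X) M ≡⟨ cong (count (_∈ᵇ X)) M≡ ⟩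
        count (_∈ᵇ X) (n * L) ≡⟨ total ⟩
        n * a           ≡⟨ heightAt-tbpWord-end a b n j (≮⇒≥ j≮nL) ⟨
        h j             ∎)
        where open ≡-Reasoning
      ... | yes j<nL with divMod-< L n j j<nL
      ...   | t , r , t<n , r≤L , refl =
              subst (count (_∈ᵇ X) (t * L + r) ≤_) (sym (heightAt-tbpWord a b n t r t<n r≤L)) (≤+⊓ rising flat)
        where
        rising : count (_∈ᵇ X) (t * L + r) ≤ t * a + r
        rising = ≤-trans (count-+ (_∈ᵇ X) (t * L) r) (+-monoˡ-≤ r (at-checkpoints t (<⇒≤ t<n)))
        flat : count (_∈ᵇ X) (t * L + r) ≤ t * a + a
        flat = ≤-trans (count-monoʳ (_∈ᵇ X) (subst (t * L + r ≤_) (+-comm (t * L) L) (+-monoʳ-≤ (t * L) r≤L)))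
                       (≤-trans (at-checkpoints (suc t) t<n) (≤-reflexive (+-comm a (t * a))))
        ≤+⊓ : ∀ {x y} → x ≤ y + r → x ≤ y + a → x ≤ y + r ⊓ a
        ≤+⊓ {x} {y} x≤y+r x≤y+a with r ≤? a
        ... | yes r≤a = subst (λ z → x ≤ y + z) (sym (m≤n⇒m⊓n≡m r≤a)) x≤y+r
        ... | no r≰a = subst (λ z → x ≤ y + z) (sym (m≥n⇒m⊓n≡n (<⇒≤ (≰⇒> r≰a)))) x≤y+a

    bounded⇒checkpoints : ∀ (X : Subset M) → BoundedBasis h (n * a) X → Checkpoints a L n X
    bounded⇒checkpoints X (bounded , ∣X∣) =
      at-checkpoints , trans (sym (cong (count (_∈ᵇ X)) M≡)) (trans (sym (∣∣≡count X)) ∣X∣)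
      where
      at-checkpoints : ∀ t → t ≤ n → count (_∈ᵇ X) (t * L) ≤ t * a
      at-checkpoints t t≤n with m≤n⇒m<n∨m≡n t≤n
      ... | inj₂ refl = ≤-trans (bounded (t * L)) (≤-reflexive (heightAt-tbpWord-end a b t (t * L) ≤-refl))
      ... | inj₁ t<n = ≤-trans (bounded (t * L)) (≤-reflexive
              (trans (cong h (sym (+-identityʳ (t * L)))) (trans (heightAt-tbpWord a b n t 0 t<n z≤n) (+-identityʳ (t * a)))))

module TennisBalls where

  open import Data.Nat
  open import Data.Nat.Properties
  open import Data.Bool using (Bool; true; false; if_then_else_; _∧_; _∨_; not)
  open import Data.Bool.Properties using (∨-identityʳ; ∨-zeroʳ)
  open import Data.List as List using (List; drop) renaming ([] to []ₗ; _∷_ to _∷ₗ_)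
  open import Data.Nat.ListAction using (sum)
  open import Data.Fin using (Fin; toℕ; fromℕ<; zero; suc)
  open import Data.Fin.Properties using (toℕ<n; toℕ-fromℕ<; toℕ-injective)
  open import Data.Fin.Subset using (Subset; ∣_∣)
  open import Data.Fin.Subset.Properties using (_∈?_)
  open import Data.Maybe using (Maybe; just; nothing; fromMaybe)
  open import Data.Vec as Vec using (Vec; []; _∷_; lookup; tabulate; toList; replicate)
  open import Data.Vec.Properties using (lookup∘tabulate; lookup-map)
  open import Data.Product using (∃-syntax; _×_; _,_; proj₁; proj₂)
  open import Data.Sum using (inj₁; inj₂)
  open import Data.Empty using (⊥-elim)
  open import Relation.Nullary using (yes; no; does)
  open import Relation.Binary.PropositionalEquality
  open import Defs
  open Counting

  private
    variable
      k m : ℕ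

  headOr0 : List ℕ → ℕ
  headOr0 []ₗ = 0
  headOr0 (x ∷ₗ _) = x

  -- l_j for 1-based j.
  binSize : Vec ℕ k → ℕ → ℕ
  binSize l j = headOr0 (drop (j ∸ 1) (toList l))

  tailSum-suc : (l : Vec ℕ k) → ∀ j → tailSum l (suc j) ≡ binSize l (suc j) + tailSum l (suc (suc j))
  tailSum-suc l j = sum-drop (toList l) j
    where
    sum-drop : ∀ xs i → sum (drop i xs) ≡ headOr0 (drop i xs) + sum (drop (suc i) xs)
    sum-drop []ₗ zero = refl
    sum-drop []ₗ (suc i) = refl
    sum-drop (x ∷ₗ xs) zero = refl
    sum-drop (x ∷ₗ xs) (suc i) = sum-drop xs i

  tailSum-end : (l : Vec ℕ k) → tailSum l (suc k) ≡ 0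
  tailSum-end l = cong sum (drop-all l)
    where
    drop-all : ∀ {k} (l : Vec ℕ k) → drop k (toList l) ≡ []ₗ
    drop-all [] = refl
    drop-all (x ∷ l) = drop-all l

  tailSum-antitone : (l : Vec ℕ k) → ∀ {j j'} → j ≤ j' → tailSum l j' ≤ tailSum l j
  tailSum-antitone l j≤j' = sum-drop-antitone (toList l) (∸-monoˡ-≤ 1 j≤j')
    where
    sum-drop-antitone : ∀ xs {a b} → a ≤ b → sum (drop b xs) ≤ sum (drop a xs)
    sum-drop-antitone []ₗ {b = zero} _ = z≤n
    sum-drop-antitone []ₗ {b = suc b} _ = z≤n
    sum-drop-antitone (x ∷ₗ xs) {zero} {zero} _ = ≤-refl
    sum-drop-antitone (x ∷ₗ xs) {zero} {suc b} _ = ≤-trans (sum-drop-antitone xs {0} {b} z≤n) (m≤n+m _ x)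
    sum-drop-antitone (x ∷ₗ xs) {suc a} {suc b} (s≤s a≤b) = sum-drop-antitone xs a≤b

  tailSum≤total : (l : Vec ℕ k) → ∀ j → tailSum l j ≤ total l
  tailSum≤total l j = tailSum-antitone l {0} {j} z≤n

  binSize-pos : (l : Vec ℕ k) → (∀ j → 0 < lookup l j) → ∀ j → j < k → 0 < binSize l (suc j)
  binSize-pos l pos j j<k = subst (0 <_) (sym (headOr0-lookup l j j<k)) (pos (fromℕ< j<k))
    where
    headOr0-lookup : ∀ {k} (l : Vec ℕ k) i (i<k : i < k) → headOr0 (drop i (toList l)) ≡ lookup l (fromℕ< i<k)
    headOr0-lookup (x ∷ l) zero _ = refl
    headOr0-lookup (x ∷ l) (suc i) (s≤s i<k) = headOr0-lookup l i i<k

  -- The bin of ball i + 1 in a state, 0 if the ball is not in play (or i ≥ m).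
  level : State m → ℕ → ℕ
  level [] i = 0
  level (x ∷ s) zero = fromMaybe 0 x
  level (x ∷ s) (suc i) = level s i

  level-lookup : (s : State m) (x : Fin m) → level s (toℕ x) ≡ fromMaybe 0 (lookup s x)
  level-lookup (y ∷ s) zero = refl
  level-lookup (y ∷ s) (suc x) = level-lookup s x

  level-out : (s : State m) → ∀ i → m ≤ i → level s i ≡ 0
  level-out [] i _ = refl
  level-out (x ∷ s) (suc i) (s≤s m≤i) = level-out s i m≤i

  level-tabulate : (f : Fin m → Maybe ℕ) (g : ℕ → ℕ) → (∀ x → fromMaybe 0 (f x) ≡ g (toℕ x)) →
    ∀ i → i < m → level (tabulate f) i ≡ g i
  level-tabulate f g f≗g i i<m =
    subst (λ z → level (tabulate f) z ≡ g z) (toℕ-fromℕ< i<m)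
      (trans (level-lookup (tabulate f) x) (trans (cong (fromMaybe 0) (lookup∘tabulate f x)) (f≗g x)))
    where x = fromℕ< i<m

  level-update : ∀ (c : Fin m → Bool) (c' : ℕ → Bool) v (s : State m) → (∀ x → c x ≡ c' (toℕ x)) →
    ∀ i → i < m → level (tabulate (λ x → if c x then just v else lookup s x)) i ≡ (if c' i then v else level s i)
  level-update c c' v s c≗c' = level-tabulate _ _ λ x → trans (fromMaybe-if (c x)) (cong₂ (λ b w → if b then v else w) (c≗c' x) (sym (level-lookup s x)))
    where
    fromMaybe-if : ∀ b {y} → fromMaybe 0 (if b then just v else y) ≡ (if b then v else fromMaybe 0 y)
    fromMaybe-if true = refl
    fromMaybe-if false = refl

  level-replicate : ∀ m i → level (replicate m (nothing {A = ℕ})) i ≡ 0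
  level-replicate zero i = refl
  level-replicate (suc m) zero = refl
  level-replicate (suc m) (suc i) = level-replicate m i

  -- The (1-based) bin of ball i + 1, 0 outside [0, m).
  stateOf : Vec (Fin k) m → State m
  stateOf = Vec.map (λ x → just (suc (toℕ x)))

  binOf : Vec (Fin k) m → ℕ → ℕ
  binOf p = level (stateOf p)

  binOf-lookup : (p : Vec (Fin k) m) (x : Fin m) → binOf p (toℕ x) ≡ suc (toℕ (lookup p x))
  binOf-lookup p x = trans (level-lookup (stateOf p) x) (cong (fromMaybe 0) (lookup-map x _ p))

  binOf-out : (p : Vec (Fin k) m) → ∀ i → m ≤ i → binOf p i ≡ 0
  binOf-out p = level-out (stateOf p)

  binOf≤k : (p : Vec (Fin k) m) → ∀ i → binOf p i ≤ k
  binOf≤k {k} {m} p i with i <? m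
  ... | no i≮m = subst (_≤ k) (sym (binOf-out p i (≮⇒≥ i≮m))) z≤n
  ... | yes i<m = subst (λ z → binOf p z ≤ k) (toℕ-fromℕ< i<m)
                    (subst (_≤ k) (sym (binOf-lookup p (fromℕ< i<m))) (toℕ<n (lookup p (fromℕ< i<m))))

  binOf-pos⇒< : (p : Vec (Fin k) m) → ∀ i → 1 ≤ binOf p i → i < m
  binOf-pos⇒< {m = m} p i pos with i <? m
  ... | yes i<m = i<m
  ... | no i≮m = ⊥-elim (<⇒≱ pos (≤-reflexive (binOf-out p i (≮⇒≥ i≮m))))

  binsFrom : Vec (Fin k) m → ℕ → ℕ → Bool
  binsFrom p j i = j ≤ᵇ binOf p i

  -- A partition is a configuration iff it satisfies BinCondition for j = 2, …, k + 1.
  BinCondition : (l : Vec ℕ k) (n : ℕ) → Vec (Fin k) (n * total l) → ℕ → Set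
  BinCondition l n p j =
    (∀ t → t ≤ n → t * tailSum l j ≤ count (binsFrom p j) (t * total l)) ×
    count (binsFrom p j) (n * total l) ≡ n * tailSum l j

  binCondition-last : (l : Vec ℕ k) (n : ℕ) (p : Vec (Fin k) (n * total l)) → BinCondition l n p (suc k)
  binCondition-last {k} l n p =
    (λ t _ → subst (_≤ count (binsFrom p (suc k)) (t * total l)) (sym (trans (cong (t *_) (tailSum-end l)) (*-zeroʳ t))) z≤n) ,
    trans (count-ext (n * total l) (λ i _ → >⇒≤ᵇ≡false (s≤s (binOf≤k p i))))
          (trans (count-false (n * total l)) (sym (trans (cong (n *_) (tailSum-end l)) (*-zeroʳ n))))

  module Necessity {k : ℕ} (l : Vec ℕ k) (n : ℕ) where
    private
      L : ℕ
      L = total l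
      M : ℕ
      M = n * L
      T : ℕ → ℕ
      T = tailSum l

    tL≤M : ∀ t → t ≤ n → t * L ≤ M
    tL≤M t t≤n = *-monoˡ-≤ L t≤n

    record Invariant (bound : ℕ) (target : ℕ → ℕ) (s : State M) : Set where
      field
        unplayed : ∀ i → bound ≤ i → level s i ≡ 0
        upper-count : ∀ j → 2 ≤ j → j ≤ k → count (λ i → j ≤ᵇ level s i) M ≡ target j

    AfterTurns : ℕ → State M → Set
    AfterTurns t = Invariant (t * L) (λ j → t * T j)

    -- During turn t + 1, once the moves into bins 2, …, j - 1 are done.
    DuringTurn : ℕ → ℕ → State M → Set
    DuringTurn t j = Invariant (suc t * L) (λ j' → if j' <ᵇ j then suc t * T j' else t * T j')

    level≤ : State M → State M → Set
    level≤ s s' = ∀ i → level s i ≤ level s' i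

    start-invariant : AfterTurns 0 (replicate M nothing)
    start-invariant = record
      { unplayed = λ i _ → level-replicate M i
      ; upper-count = λ j 2≤j _ → trans (count-ext M (λ i _ → trans (cong (j ≤ᵇ_) (level-replicate M i))
                                                                      (>⇒≤ᵇ≡false (≤-trans (s≤s z≤n) 2≤j))))
                                        (count-false M)
      }

    module InsertStep (t : ℕ) (t<n : t < n) (s : State M) (inv : AfterTurns t s) where
      open Invariant inv
      σ : State M
      σ = insertTurn L t s

      new : ℕ → Bool
      new i = (t * L ≤ᵇ i) ∧ (i <ᵇ suc t * L)

      level-σ : ∀ i → i < M → level σ i ≡ (if new i then 1 else level s i)
      level-σ = level-update _ new 1 s (λ _ → refl)

      new⇒unplayed : ∀ i → new i ≡ true → level s i ≡ 0
      new⇒unplayed i new-i = unplayed i (≤ᵇ≡true⇒≤ (∧≡true⇒ˡ new-i))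

      threshold-σ : ∀ j → 2 ≤ j → ∀ i → i < M → (j ≤ᵇ level σ i) ≡ (j ≤ᵇ level s i)
      threshold-σ j 2≤j i i<M rewrite level-σ i i<M with new i in new-i
      ... | false = refl
      ... | true = trans (>⇒≤ᵇ≡false 2≤j) (sym (trans (cong (j ≤ᵇ_) (new⇒unplayed i new-i)) (>⇒≤ᵇ≡false (≤-trans (s≤s z≤n) 2≤j))))

      invariant : DuringTurn t 2 σ
      invariant = record { unplayed = unplayed-σ ; upper-count = upper-count-σ }
        where
        unplayed-σ : ∀ i → suc t * L ≤ i → level σ i ≡ 0
        unplayed-σ i bound≤i with i <? M
        ... | no i≮M = level-out σ i (≮⇒≥ i≮M)
        ... | yes i<M rewrite level-σ i i<M with new i in new-i
        ...   | true = ⊥-elim (<⇒≱ (<ᵇ≡true⇒< (∧≡true⇒ʳ {t * L ≤ᵇ i} new-i)) bound≤i)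
        ...   | false = unplayed i (≤-trans (*-monoˡ-≤ L (n≤1+n t)) bound≤i)
        upper-count-σ : ∀ j → 2 ≤ j → j ≤ k → count (λ i → j ≤ᵇ level σ i) M ≡ (if j <ᵇ 2 then suc t * T j else t * T j)
        upper-count-σ j 2≤j j≤k rewrite ≮⇒<ᵇ≡false (λ j<2 → <⇒≱ j<2 2≤j) =
          trans (count-ext M (λ i i<M → threshold-σ j 2≤j i i<M)) (upper-count j 2≤j j≤k)

      level-mono : level≤ s σ
      level-mono i with i <? M
      ... | no i≮M = ≤-reflexive (trans (level-out s i (≮⇒≥ i≮M)) (sym (level-out σ i (≮⇒≥ i≮M))))
      ... | yes i<M rewrite level-σ i i<M with new i in new-i
      ...   | false = ≤-refl
      ...   | true = subst (_≤ 1) (sym (new⇒unplayed i new-i)) z≤n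

    module MoveStep {c j : ℕ} (2≤j : 2 ≤ j) {σ σ₁ : State M} (mv : Move c j σ σ₁) where
      S : Subset M
      S = proj₁ mv
      ∣S∣ : ∣ S ∣ ≡ c
      ∣S∣ = proj₁ (proj₂ mv)

      level-σ₁ : ∀ i → i < M → level σ₁ i ≡ (if i ∈ᵇ S then j else level σ i)
      level-σ₁ i i<M = trans (cong (λ z → level z i) (proj₂ (proj₂ (proj₂ mv))))
        (level-update (λ x → does (x ∈? S)) (_∈ᵇ S) j σ (λ x → trans (does-∈?≡lookup x S) (sym (∈ᵇ-lookup S x))) i i<M)

      moved-level : ∀ i → (i ∈ᵇ S) ≡ true → level σ i ≡ pred j
      moved-level i i∈S = subst (λ z → level σ z ≡ pred j) (toℕ-fromℕ< i<M)
        (trans (level-lookup σ x) (cong (fromMaybe 0) (proj₁ (proj₂ (proj₂ mv)) x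
          (∈ᵇ⇒∈ (subst (λ z → (z ∈ᵇ S) ≡ true) (sym (toℕ-fromℕ< i<M)) i∈S)))))
        where
        i<M : i < M
        i<M = ∈ᵇ⇒< S i i∈S
        x : Fin M
        x = fromℕ< i<M

      pred-j<j : pred j < j
      pred-j<j = pred-< 2≤j
        where
        pred-< : ∀ {x} → 2 ≤ x → pred x < x
        pred-< {suc x} _ = n<1+n x

      threshold-other : ∀ j' → j' ≢ j → ∀ i → i < M → (j' ≤ᵇ level σ₁ i) ≡ (j' ≤ᵇ level σ i)
      threshold-other j' j'≢j i i<M rewrite level-σ₁ i i<M with i ∈ᵇ S in i∈S
      ... | false = refl
      ... | true rewrite moved-level i i∈S with j' ≤? pred j
      ...   | yes j'≤pred-j = trans (≤⇒≤ᵇ≡true (≤-trans j'≤pred-j pred[n]≤n)) (sym (≤⇒≤ᵇ≡true j'≤pred-j))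
      ...   | no j'≰pred-j = trans (>⇒≤ᵇ≡false (≤∧≢⇒< (pred<⇒≤ j (≰⇒> j'≰pred-j)) (λ j≡j' → j'≢j (sym j≡j'))))
                                   (sym (>⇒≤ᵇ≡false (≰⇒> j'≰pred-j)))
        where
        pred<⇒≤ : ∀ x → pred x < j' → x ≤ j'
        pred<⇒≤ zero _ = z≤n
        pred<⇒≤ (suc x) lt = lt

      threshold-j : ∀ i → i < M → (j ≤ᵇ level σ₁ i) ≡ ((j ≤ᵇ level σ i) ∨ (i ∈ᵇ S))
      threshold-j i i<M rewrite level-σ₁ i i<M with i ∈ᵇ S
      ... | true = trans (≤⇒≤ᵇ≡true (≤-refl {j})) (sym (∨-zeroʳ (j ≤ᵇ level σ i)))
      ... | false = sym (∨-identityʳ (j ≤ᵇ level σ i))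

      count-threshold-j : count (λ i → j ≤ᵇ level σ₁ i) M ≡ count (λ i → j ≤ᵇ level σ i) M + c
      count-threshold-j =
        trans (count-ext M threshold-j)
          (trans (count-∨ (λ i → j ≤ᵇ level σ i) (_∈ᵇ S) disjoint M)
                 (cong (count (λ i → j ≤ᵇ level σ i) M +_) (trans (sym (∣∣≡count S)) ∣S∣)))
        where
        disjoint : ∀ i → (j ≤ᵇ level σ i) ≡ true → (i ∈ᵇ S) ≡ false
        disjoint i above with i ∈ᵇ S in i∈S
        ... | false = refl
        ... | true = ⊥-elim (<⇒≱ (subst (_< j) (sym (moved-level i i∈S)) pred-j<j) (≤ᵇ≡true⇒≤ above))

      level-mono : level≤ σ σ₁
      level-mono i with i <? M
      ... | no i≮M = ≤-reflexive (trans (level-out σ i (≮⇒≥ i≮M)) (sym (level-out σ₁ i (≮⇒≥ i≮M))))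
      ... | yes i<M rewrite level-σ₁ i i<M with i ∈ᵇ S in i∈S
      ...   | true = subst (_≤ j) (sym (moved-level i i∈S)) pred[n]≤n
      ...   | false = ≤-refl

      unplayed-σ₁ : ∀ bound → (∀ i → bound ≤ i → level σ i ≡ 0) → ∀ i → bound ≤ i → level σ₁ i ≡ 0
      unplayed-σ₁ bound unplayed i bound≤i with i <? M
      ... | no i≮M = level-out σ₁ i (≮⇒≥ i≮M)
      ... | yes i<M rewrite level-σ₁ i i<M with i ∈ᵇ S in i∈S
      ...   | false = unplayed i bound≤i
      ...   | true = ⊥-elim (<⇒≱ (pred-pos 2≤j) (≤-reflexive (trans (sym (moved-level i i∈S)) (unplayed i bound≤i))))
        where
        pred-pos : ∀ {x} → 2 ≤ x → 0 < pred x
        pred-pos {suc (suc x)} _ = s≤s z≤n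
        pred-pos {suc zero} (s≤s ())

    move-invariant : ∀ {t j σ σ₁} → 2 ≤ j → Move (T j) j σ σ₁ → DuringTurn t j σ → DuringTurn t (suc j) σ₁
    move-invariant {t} {j} {σ} {σ₁} 2≤j mv inv = record
      { unplayed = unplayed-σ₁ (suc t * L) unplayed
      ; upper-count = upper-count-σ₁
      }
      where
      open Invariant inv
      open MoveStep 2≤j {σ} {σ₁} mv
      upper-count-σ₁ : ∀ j' → 2 ≤ j' → j' ≤ k →
        count (λ i → j' ≤ᵇ level σ₁ i) M ≡ (if j' <ᵇ suc j then suc t * T j' else t * T j')
      upper-count-σ₁ j' 2≤j' j'≤k with j' ≟ j
      ... | yes refl rewrite <⇒<ᵇ≡true (n<1+n j) = begin
        count (λ i → j ≤ᵇ level σ₁ i) M      ≡⟨ count-threshold-j ⟩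
        count (λ i → j ≤ᵇ level σ i) M + T j ≡⟨ cong (_+ T j) (upper-count j 2≤j' j'≤k) ⟩
        (if j <ᵇ j then suc t * T j else t * T j) + T j ≡⟨ cong (λ b → (if b then suc t * T j else t * T j) + T j) (≮⇒<ᵇ≡false (n≮n j)) ⟩
        t * T j + T j                        ≡⟨ +-comm (t * T j) (T j) ⟩
        suc t * T j                          ∎
        where open ≡-Reasoning
      ... | no j'≢j = trans (count-ext M (threshold-other j' j'≢j))
                            (trans (upper-count j' 2≤j' j'≤k)
                                   (cong (λ b → if b then suc t * T j' else t * T j') (sym <ᵇ-suc)))
        where
        <ᵇ-suc : (j' <ᵇ suc j) ≡ (j' <ᵇ j)
        <ᵇ-suc with j' <? j
        ... | yes j'<j = trans (<⇒<ᵇ≡true (m<n⇒m<1+n j'<j)) (sym (<⇒<ᵇ≡true j'<j))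
        ... | no j'≮j = trans (≮⇒<ᵇ≡false (λ j'<1+j → j'≮j (≤∧≢⇒< (≤-pred j'<1+j) j'≢j))) (sym (≮⇒<ᵇ≡false j'≮j))

    moves-invariant : ∀ {t j σ σ'} → Moves l j σ σ' → 2 ≤ j → DuringTurn t j σ → AfterTurns (suc t) σ' × level≤ σ σ'
    moves-invariant {t} (done k<j) 2≤j inv =
      record { unplayed = Invariant.unplayed inv
             ; upper-count = λ j' 2≤j' j'≤k → trans (Invariant.upper-count inv j' 2≤j' j'≤k)
                                                    (cong (λ b → if b then suc t * T j' else t * T j') (<⇒<ᵇ≡true (≤-<-trans j'≤k k<j))) } ,
      λ i → ≤-refl
    moves-invariant {t} (step {s = σ} {s₁ = σ₁} j≤k mv rest) 2≤j inv
      with moves-invariant {t} rest (m≤n⇒m≤1+n 2≤j) (move-invariant {t} {σ = σ} {σ₁} 2≤j mv inv)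
    ... | inv' , mono = inv' , λ i → ≤-trans (MoveStep.level-mono 2≤j {σ} {σ₁} mv i) (mono i)

    run-invariant : ∀ {t s} → Run l t s → t ≤ n →
      AfterTurns t s × (∀ t' → t' ≤ t → ∃[ s' ] (AfterTurns t' s' × level≤ s' s))
    run-invariant start _ = start-invariant , λ { .0 z≤n → replicate M nothing , start-invariant , λ i → ≤-refl }
    run-invariant (turn {t} {s} {s'} run mvs) t<n with run-invariant run (≤-trans (n≤1+n t) t<n)
    ... | inv , earlier with moves-invariant {t} mvs ≤-refl (InsertStep.invariant t t<n s inv)
    ...   | inv' , mono = inv' , earlier'
      where
      s≤s' : level≤ s s'
      s≤s' i = ≤-trans (InsertStep.level-mono t t<n s inv i) (mono i)
      earlier' : ∀ t' → t' ≤ suc t → ∃[ s'' ] (AfterTurns t' s'' × level≤ s'' s')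
      earlier' t' t'≤1+t with m≤n⇒m<n∨m≡n t'≤1+t
      ... | inj₂ refl = s' , inv' , λ i → ≤-refl
      ... | inj₁ (s≤s t'≤t) with earlier t' t'≤t
      ...   | s'' , inv'' , s''≤s = s'' , inv'' , λ i → ≤-trans (s''≤s i) (s≤s' i)

    -- Levels only grow, so the bins j, …, k of the final partition already hold the
    -- t T_j balls that were there after turn t, all of them among the first tL.
    configuration⇒binCondition : ∀ p → Configuration l n p → ∀ j → 2 ≤ j → j ≤ suc k → BinCondition l n p j
    configuration⇒binCondition p (s , run , refl) j 2≤j j≤1+k with m≤n⇒m<n∨m≡n j≤1+k
    ... | inj₂ refl = binCondition-last l n p
    ... | inj₁ (s≤s j≤k) = at-turns , final
      where
      final : count (binsFrom p j) M ≡ n * T j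
      final = Invariant.upper-count (proj₁ (run-invariant run ≤-refl)) j 2≤j j≤k
      at-turns : ∀ t → t ≤ n → t * T j ≤ count (binsFrom p j) (t * L)
      at-turns t t≤n with proj₂ (run-invariant run ≤-refl) t t≤n
      ... | s' , inv , s'≤s = begin
        t * T j                                  ≡⟨ Invariant.upper-count inv j 2≤j j≤k ⟨
        count (λ i → j ≤ᵇ level s' i) M         ≡⟨ count-constant _ (tL≤M t t≤n) unplayed-above ⟩
        count (λ i → j ≤ᵇ level s' i) (t * L)   ≤⟨ count-mono (t * L) (λ i above → ≤⇒≤ᵇ≡true (≤-trans (≤ᵇ≡true⇒≤ {j} above) (s'≤s i))) ⟩
        count (binsFrom p j) (t * L)             ∎
        where
        open ≤-Reasoning
        unplayed-above : ∀ i → t * L ≤ i → i < M → (j ≤ᵇ level s' i) ≡ false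
        unplayed-above i tL≤i _ = trans (cong (j ≤ᵇ_) (Invariant.unplayed inv i tL≤i)) (>⇒≤ᵇ≡false (≤-trans (s≤s z≤n) 2≤j))

    count-binsFrom : ∀ p → Configuration l n p → ∀ j → 1 ≤ j → j ≤ suc k → count (binsFrom p j) M ≡ n * T j
    count-binsFrom p conf (suc zero) _ _ = count-all (binsFrom p 1) M (λ ι ι<M → ≤⇒≤ᵇ≡true (in-some-bin ι ι<M))
      where
      in-some-bin : ∀ ι → ι < M → 1 ≤ binOf p ι
      in-some-bin ι ι<M = subst (λ z → 1 ≤ binOf p z) (toℕ-fromℕ< ι<M) (subst (1 ≤_) (sym (binOf-lookup p (fromℕ< ι<M))) (s≤s z≤n))
    count-binsFrom p conf (suc (suc j)) _ j≤1+k = proj₂ (configuration⇒binCondition p conf (suc (suc j)) (s≤s (s≤s z≤n)) j≤1+k)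

    inBin : Vec (Fin k) M → ℕ → ℕ → Bool
    inBin p w ι = binsFrom p (suc w) ι ∧ not (binsFrom p (2 + w) ι)

    count-inBin : ∀ p → Configuration l n p → ∀ w → w < k → count (inBin p w) M ≡ n * binSize l (suc w)
    count-inBin p conf w w<k = +-cancelʳ-≡ (n * T (2 + w)) _ _ (begin
      count (inBin p w) M + n * T (2 + w)                ≡⟨ cong (count (inBin p w) M +_) (count-binsFrom p conf (2 + w) (s≤s z≤n) (s≤s w<k)) ⟨
      count (inBin p w) M + count (binsFrom p (2 + w)) M ≡⟨ count-∧-not (binsFrom p (2 + w)) (binsFrom p (suc w)) higher⊆ M ⟩
      count (binsFrom p (suc w)) M                       ≡⟨ count-binsFrom p conf (suc w) (s≤s z≤n) (s≤s (<⇒≤ w<k)) ⟩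
      n * T (suc w)                                      ≡⟨ cong (n *_) (tailSum-suc l w) ⟩
      n * (binSize l (suc w) + T (2 + w))                ≡⟨ *-distribˡ-+ n (binSize l (suc w)) (T (2 + w)) ⟩
      n * binSize l (suc w) + n * T (2 + w)              ∎)
      where
      open ≡-Reasoning
      higher⊆ : binsFrom p (2 + w) ⊆ᵇ binsFrom p (suc w)
      higher⊆ ι above = ≤⇒≤ᵇ≡true (≤-trans (n≤1+n (suc w)) (≤ᵇ≡true⇒≤ {2 + w} {binOf p ι} above))

    inBin⇒binOf : ∀ p w ι → inBin p w ι ≡ true → binOf p ι ≡ suc w
    inBin⇒binOf p w ι ι∈bin =
      ≤-antisym (≤-pred (≤ᵇ≡false⇒> {2 + w} {binOf p ι} (not≡true⇒ (∧≡true⇒ʳ {binsFrom p (suc w) ι} ι∈bin))))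
                (≤ᵇ≡true⇒≤ {suc w} {binOf p ι} (∧≡true⇒ˡ ι∈bin))

    configuration⇒isOrderedPartition : (∀ j → 0 < lookup l j) → 1 ≤ n → ∀ p → Configuration l n p → IsOrderedPartition p
    configuration⇒isOrderedPartition pos n≥1 p conf w
      with count-pos⇒last (inBin p (toℕ w)) M
             (subst (0 <_) (sym (count-inBin p conf (toℕ w) (toℕ<n w))) (*-mono-≤ n≥1 (binSize-pos l pos (toℕ w) (toℕ<n w))))
    ... | ι , ι<M , ι∈bin , _ = fromℕ< ι<M , toℕ-injective (suc-injective (begin
      suc (toℕ (lookup p (fromℕ< ι<M))) ≡⟨ binOf-lookup p (fromℕ< ι<M) ⟨
      binOf p (toℕ (fromℕ< ι<M))        ≡⟨ cong (binOf p) (toℕ-fromℕ< ι<M) ⟩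
      binOf p ι                         ≡⟨ inBin⇒binOf p (toℕ w) ι ι∈bin ⟩
      suc (toℕ w)                       ∎))
      where open ≡-Reasoning

module Scheduling where

  open import Data.Nat
  open import Data.Nat.Properties
  open import Data.Bool using (Bool; true; false; _∧_; _∨_; not)
  open import Data.Sum using (inj₁; inj₂)
  open import Data.Empty using (⊥-elim)
  open import Relation.Nullary using (yes; no)
  open import Relation.Binary.PropositionalEquality
  open Counting

  -- Used with Q d the balls in the top d bins of a partition: schedule d t are the balls there after t turns.
  module Schedule (L n : ℕ) (Q : ℕ → ℕ → Bool) (U ℓ : ℕ → ℕ) (D : ℕ)
    (U-zero : U 0 ≡ 0)
    (U-suc : ∀ d → d < D → U (suc d) ≡ ℓ d + U d)
    (Q-zero : ∀ i → Q 0 i ≡ false)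
    (Q-mono : ∀ d → d < D → Q d ⊆ᵇ Q (suc d))
    (Q-bounded : ∀ d → d ≤ D → ∀ i → Q d i ≡ true → i < n * L)
    (Q-early : ∀ d → d ≤ D → ∀ t → t ≤ n → t * U d ≤ count (Q d) (t * L))
    (Q-size : ∀ d → d ≤ D → count (Q d) (n * L) ≡ n * U d) where

    private
      M : ℕ
      M = n * L

    schedule : ℕ → ℕ → ℕ → Bool
    fresh : ℕ → ℕ → ℕ → Bool
    schedule zero t i = false
    schedule (suc d) t i = schedule d t i ∨ first (t * ℓ d) (fresh d t) i
    fresh d t i = Q (suc d) i ∧ not (schedule d t i)

    tL≤M : ∀ t → t ≤ n → t * L ≤ M
    tL≤M t t≤n = *-monoˡ-≤ L t≤n

    schedule-nested : ∀ d t → schedule d t ⊆ᵇ schedule (suc d) t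
    schedule-nested d t i = ∨≡trueˡ _

    schedule⊆Q : ∀ d → d ≤ D → ∀ t → schedule d t ⊆ᵇ Q d
    schedule⊆Q (suc d) d<D t i i∈S with ∨≡true⇒ {schedule d t i} i∈S
    ... | inj₁ old = Q-mono d d<D i (schedule⊆Q d (<⇒≤ d<D) t i old)
    ... | inj₂ new = ∧≡true⇒ˡ (first⊆ (t * ℓ d) (fresh d t) i new)

    fresh-disjoint : ∀ d t i → schedule d t i ≡ true → first (t * ℓ d) (fresh d t) i ≡ false
    fresh-disjoint d t i i∈S with first (t * ℓ d) (fresh d t) i in i-new
    ... | false = refl
    ... | true = ⊥-elim (false≢true (trans (sym (not≡true⇒ (∧≡true⇒ʳ {Q (suc d) i} (first⊆ (t * ℓ d) (fresh d t) i i-new)))) i∈S))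

    count-fresh : ∀ d → d < D → ∀ t j → count (fresh d t) j + count (schedule d t) j ≡ count (Q (suc d)) j
    count-fresh d d<D t = count-∧-not (schedule d t) (Q (suc d)) (λ i i∈S → Q-mono d d<D i (schedule⊆Q d (<⇒≤ d<D) t i i∈S))

    mutual
      count-schedule : ∀ d → d ≤ D → ∀ t → t ≤ n → count (schedule d t) M ≡ t * U d
      count-schedule zero _ t _ = trans (count-false M) (sym (trans (cong (t *_) U-zero) (*-zeroʳ t)))
      count-schedule (suc d) d<D t t≤n = begin
        count (schedule (suc d) t) M                                   ≡⟨ count-∨ (schedule d t) _ (fresh-disjoint d t) M ⟩
        count (schedule d t) M + count (first (t * ℓ d) (fresh d t)) M ≡⟨ cong₂ _+_ (count-schedule d (<⇒≤ d<D) t t≤n) (count-first (t * ℓ d) (fresh d t) M) ⟩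
        t * U d + t * ℓ d ⊓ count (fresh d t) M                 ≡⟨ cong (t * U d +_) (m≤n⇒m⊓n≡m (enough-fresh d d<D t t≤n)) ⟩
        t * U d + t * ℓ d                                       ≡⟨ +-comm (t * U d) (t * ℓ d) ⟩
        t * ℓ d + t * U d                                       ≡⟨ *-distribˡ-+ t (ℓ d) (U d) ⟨
        t * (ℓ d + U d)                                         ≡⟨ cong (t *_) (U-suc d d<D) ⟨
        t * U (suc d)                                           ∎
        where open ≡-Reasoning

      enough-fresh : ∀ d → d < D → ∀ t → t ≤ n → t * ℓ d ≤ count (fresh d t) M
      enough-fresh d d<D t t≤n = +-cancelʳ-≤ (t * U d) _ _ (begin
        t * ℓ d + t * U d                   ≤⟨ +-mono-≤ (*-monoˡ-≤ (ℓ d) t≤n) (*-monoˡ-≤ (U d) t≤n) ⟩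
        n * ℓ d + n * U d                   ≡⟨ *-distribˡ-+ n (ℓ d) (U d) ⟨
        n * (ℓ d + U d)                     ≡⟨ cong (n *_) (U-suc d d<D) ⟨
        n * U (suc d)                       ≡⟨ Q-size (suc d) d<D ⟨
        count (Q (suc d)) M                 ≡⟨ count-fresh d d<D t M ⟨
        count (fresh d t) M + count (schedule d t) M ≡⟨ cong (count (fresh d t) M +_) (count-schedule d (<⇒≤ d<D) t t≤n) ⟩
        count (fresh d t) M + t * U d       ∎)
        where open ≤-Reasoning

    -- Below tL there are already t ℓ d fresh elements, so the first t ℓ d of them lie below tL.
    schedule-early : ∀ d → d ≤ D → ∀ t → t ≤ n → ∀ i → schedule d t i ≡ true → i < t * L
    schedule-early (suc d) d<D t t≤n i i∈S with ∨≡true⇒ {schedule d t i} i∈S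
    ... | inj₁ old = schedule-early d (<⇒≤ d<D) t t≤n i old
    ... | inj₂ new with i <? t * L
    ...   | yes i<tL = i<tL
    ...   | no i≮tL = ⊥-elim (<⇒≱ (<ᵇ≡true⇒< (∧≡true⇒ʳ {fresh d t i} new)) (≤-trans fresh-below-tL (count-monoʳ (fresh d t) (≮⇒≥ i≮tL))))
      where
      open ≤-Reasoning
      fresh-below-tL : t * ℓ d ≤ count (fresh d t) (t * L)
      fresh-below-tL = +-cancelʳ-≤ (t * U d) _ _ (begin
        t * ℓ d + t * U d                                   ≡⟨ *-distribˡ-+ t (ℓ d) (U d) ⟨
        t * (ℓ d + U d)                                     ≡⟨ cong (t *_) (U-suc d d<D) ⟨
        t * U (suc d)                                       ≤⟨ Q-early (suc d) d<D t t≤n ⟩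
        count (Q (suc d)) (t * L)                           ≡⟨ count-fresh d d<D t (t * L) ⟨
        count (fresh d t) (t * L) + count (schedule d t) (t * L)   ≤⟨ +-monoʳ-≤ _ (count-monoʳ (schedule d t) (tL≤M t t≤n)) ⟩
        count (fresh d t) (t * L) + count (schedule d t) M         ≡⟨ cong (count (fresh d t) (t * L) +_) (count-schedule d (<⇒≤ d<D) t t≤n) ⟩
        count (fresh d t) (t * L) + t * U d                 ∎)

    schedule-grows : ∀ d → d ≤ D → ∀ t → schedule d t ⊆ᵇ schedule d (suc t)
    schedule-grows (suc d) d<D t i i∈S with ∨≡true⇒ {schedule d t i} i∈S
    ... | inj₁ old = ∨≡trueˡ _ (schedule-grows d (<⇒≤ d<D) t i old)
    ... | inj₂ new with schedule d (suc t) i in i∈next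
    ...   | true = refl
    ...   | false = ∧≡true (∧≡true (∧≡true⇒ˡ i-fresh) refl) (<⇒<ᵇ≡true rank-bound)
      where
      i-fresh : fresh d t i ≡ true
      i-fresh = first⊆ (t * ℓ d) (fresh d t) i new
      fresh-shrinks : fresh d (suc t) ⊆ᵇ fresh d t
      fresh-shrinks i' i'-fresh with schedule d t i' in i'∈S
      ... | false = ∧≡true (∧≡true⇒ˡ i'-fresh) refl
      ... | true = ⊥-elim (false≢true (trans (sym (not≡true⇒ (∧≡true⇒ʳ {Q (suc d) i'} i'-fresh)))
                                             (schedule-grows d (<⇒≤ d<D) t i' i'∈S)))
      rank-bound : count (fresh d (suc t)) i < suc t * ℓ d
      rank-bound = ≤-trans (s≤s (count-mono i fresh-shrinks))
                     (≤-trans (<ᵇ≡true⇒< (∧≡true⇒ʳ {fresh d t i} new)) (m≤n+m (t * ℓ d) (ℓ d)))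

    schedule-final : ∀ d → d ≤ D → ∀ i → schedule d n i ≡ Q d i
    schedule-final zero _ i = sym (Q-zero i)
    schedule-final (suc d) d<D i with Q d i in i∈Q
    ... | true = trans (cong (_∨ first (n * ℓ d) (fresh d n) i) (trans (schedule-final d (<⇒≤ d<D) i) i∈Q)) (sym (Q-mono d d<D i i∈Q))
    ... | false = trans (cong (_∨ first (n * ℓ d) (fresh d n) i) (trans (schedule-final d (<⇒≤ d<D) i) i∈Q)) all-fresh-taken
      where
      size-fresh : count (fresh d n) M ≡ n * ℓ d
      size-fresh = +-cancelʳ-≡ (n * U d) _ _ (begin
        count (fresh d n) M + n * U d         ≡⟨ cong (count (fresh d n) M +_) (count-schedule d (<⇒≤ d<D) n ≤-refl) ⟨
        count (fresh d n) M + count (schedule d n) M ≡⟨ count-fresh d d<D n M ⟩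
        count (Q (suc d)) M                   ≡⟨ Q-size (suc d) d<D ⟩
        n * U (suc d)                         ≡⟨ cong (n *_) (U-suc d d<D) ⟩
        n * (ℓ d + U d)                       ≡⟨ *-distribˡ-+ n (ℓ d) (U d) ⟩
        n * ℓ d + n * U d                     ∎)
        where open ≡-Reasoning
      all-fresh-taken : first (n * ℓ d) (fresh d n) i ≡ Q (suc d) i
      all-fresh-taken with Q (suc d) i in i∈Q'
      ... | false = refl
      ... | true = ∧≡true (not≡true (trans (schedule-final d (<⇒≤ d<D) i) i∈Q))
                          (<⇒<ᵇ≡true (subst (_≤ n * ℓ d) (count-suc-true (fresh d n) i i-fresh)
                            (subst (count (fresh d n) (suc i) ≤_) size-fresh
                              (count-monoʳ (fresh d n) (Q-bounded (suc d) d<D i i∈Q')))))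
        where
        i-fresh : fresh d n i ≡ true
        i-fresh = ∧≡true i∈Q' (not≡true (trans (schedule-final d (<⇒≤ d<D) i) i∈Q))

module Sufficiency where

  open import Data.Nat
  open import Data.Nat.Properties
  open import Data.Bool using (Bool; true; false; if_then_else_; _∧_; not)
  open import Data.Fin using (Fin; toℕ)
  open import Data.Fin.Properties using (toℕ<n)
  open import Data.Fin.Subset using (Subset; _∈_; ∣_∣)
  open import Data.Fin.Subset.Properties using (_∈?_)
  open import Data.Maybe using (just; nothing)
  open import Data.Vec using (Vec; _∷_; lookup; tabulate; replicate)
  open import Data.Vec.Properties using (lookup∘tabulate; tabulate-cong; tabulate∘lookup; lookup-map)
  open import Data.Product using (_,_; proj₁; proj₂)
  open import Data.Sum using (inj₁; inj₂)
  open import Data.Empty using (⊥-elim)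
  open import Relation.Nullary using (yes; no; does)
  open import Relation.Binary.PropositionalEquality
  open import Defs
  open Counting
  open TennisBalls
  open Scheduling

  suc-∸ : ∀ k d → d ≤ k → suc k ∸ d ≡ suc (k ∸ d)
  suc-∸ k d d≤k = +-∸-assoc 1 d≤k

  stateFrom : ∀ {M} (k bound : ℕ) → (ℕ → ℕ → Bool) → State M
  stateFrom k bound inBinsFrom =
    tabulate (λ x → if toℕ x <ᵇ bound then just (suc (count (λ u → inBinsFrom (2 + u) (toℕ x)) (k ∸ 1))) else nothing)

  module Realisation {k : ℕ} (l : Vec ℕ k) (n : ℕ) (k≥1 : 1 ≤ k) (p : Vec (Fin k) (n * total l))
                     (conditions : ∀ j → 2 ≤ j → j ≤ suc k → BinCondition l n p j) where
    private
      L : ℕ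
      L = total l
      M : ℕ
      M = n * L
      T : ℕ → ℕ
      T = tailSum l
      D : ℕ
      D = k ∸ 1

    2≤suc-k∸ : ∀ d → d ≤ D → 2 ≤ suc k ∸ d
    2≤suc-k∸ d d≤D = subst (2 ≤_) (sym (suc-∸ k d (≤-trans d≤D (m∸n≤m k 1)))) (s≤s (1≤k∸ k d k≥1 d≤D))
      where
      1≤k∸ : ∀ k d → 1 ≤ k → d ≤ k ∸ 1 → 1 ≤ k ∸ d
      1≤k∸ (suc k) zero _ _ = s≤s z≤n
      1≤k∸ (suc (suc k)) (suc d) _ (s≤s d≤k) = 1≤k∸ (suc k) d (s≤s z≤n) d≤k
      1≤k∸ (suc zero) (suc d) _ ()

    private
      d≤k : ∀ {d} → d < D → d ≤ k
      d≤k d<D = ≤-trans (<⇒≤ d<D) (m∸n≤m k 1)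
      U-suc : ∀ d → d < D → T (suc k ∸ suc d) ≡ binSize l (k ∸ d) + T (suc k ∸ d)
      U-suc d d<D with k ∸ d in k∸d | 2≤suc-k∸ (suc d) d<D
      ... | suc j | _ = trans (tailSum-suc l j) (cong (λ z → binSize l (suc j) + T z) (sym (trans (suc-∸ k d (d≤k d<D)) (cong suc k∸d))))
      ... | zero | ()
      Q-zero : ∀ i → binsFrom p (suc k) i ≡ false
      Q-zero i = >⇒≤ᵇ≡false (s≤s (binOf≤k p i))
      Q-mono : ∀ d → d < D → binsFrom p (suc k ∸ d) ⊆ᵇ binsFrom p (suc k ∸ suc d)
      Q-mono d d<D i i∈Q = ≤⇒≤ᵇ≡true (≤-trans (n≤1+n _)
        (≤ᵇ≡true⇒≤ {suc (k ∸ d)} (subst (λ z → (z ≤ᵇ binOf p i) ≡ true) (suc-∸ k d (d≤k d<D)) i∈Q)))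
      Q-bounded : ∀ d → d ≤ D → ∀ i → binsFrom p (suc k ∸ d) i ≡ true → i < M
      Q-bounded d d≤D i i∈Q = binOf-pos⇒< p i (≤-trans (≤-trans (s≤s z≤n) (2≤suc-k∸ d d≤D)) (≤ᵇ≡true⇒≤ {suc k ∸ d} i∈Q))

    open Schedule L n (λ d → binsFrom p (suc k ∸ d)) (λ d → T (suc k ∸ d)) (λ d → binSize l (k ∸ d)) D
      (tailSum-end l) U-suc Q-zero Q-mono Q-bounded
      (λ d d≤D → proj₁ (conditions (suc k ∸ d) (2≤suc-k∸ d d≤D) (m∸n≤m (suc k) d)))
      (λ d d≤D → proj₂ (conditions (suc k ∸ d) (2≤suc-k∸ d d≤D) (m∸n≤m (suc k) d)))

    binsFromAfter : ℕ → ℕ → ℕ → Bool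
    binsFromAfter j t = schedule (suc k ∸ j) t

    private
      d≤D : ∀ j → 2 ≤ j → suc k ∸ j ≤ D
      d≤D j 2≤j = ∸-monoʳ-≤ (suc k) 2≤j

      suc-k∸suc-k∸ : ∀ j → j ≤ suc k → suc k ∸ (suc k ∸ j) ≡ j
      suc-k∸suc-k∸ j j≤1+k = m∸[m∸n]≡n j≤1+k

    count-binsFromAfter : ∀ j → 2 ≤ j → j ≤ suc k → ∀ t → t ≤ n → count (binsFromAfter j t) M ≡ t * T j
    count-binsFromAfter j 2≤j j≤1+k t t≤n = trans (count-schedule (suc k ∸ j) (d≤D j 2≤j) t t≤n) (cong (λ z → t * T z) (suc-k∸suc-k∸ j j≤1+k))

    binsFromAfter-early : ∀ j → 2 ≤ j → ∀ t → t ≤ n → ∀ i → binsFromAfter j t i ≡ true → i < t * L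
    binsFromAfter-early j 2≤j = schedule-early (suc k ∸ j) (d≤D j 2≤j)

    binsFromAfter-grows : ∀ j → 2 ≤ j → ∀ t → binsFromAfter j t ⊆ᵇ binsFromAfter j (suc t)
    binsFromAfter-grows j 2≤j = schedule-grows (suc k ∸ j) (d≤D j 2≤j)

    binsFromAfter-final : ∀ j → 2 ≤ j → j ≤ suc k → ∀ i → binsFromAfter j n i ≡ binsFrom p j i
    binsFromAfter-final j 2≤j j≤1+k i = trans (schedule-final (suc k ∸ j) (d≤D j 2≤j) i) (cong (λ z → binsFrom p z i) (suc-k∸suc-k∸ j j≤1+k))

    binsFromAfter-nested : ∀ j' j → j' ≤ j → j ≤ suc k → ∀ t → binsFromAfter j t ⊆ᵇ binsFromAfter j' t
    binsFromAfter-nested j' j j'≤j j≤1+k t with m≤n⇒m<n∨m≡n j'≤j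
    ... | inj₂ refl = λ i i∈S → i∈S
    binsFromAfter-nested j' (suc j) _ j≤1+k t | inj₁ (s≤s j'≤j) = λ i i∈S →
      binsFromAfter-nested j' j j'≤j (≤-trans (n≤1+n j) j≤1+k) t i
        (subst (λ z → schedule z t i ≡ true) (sym (suc-∸ k j (≤-pred j≤1+k))) (schedule-nested (k ∸ j) t i i∈S))

    2+u≤k : ∀ u → u < D → 2 + u ≤ k
    2+u≤k u u<D = subst (2 + u ≤_) (m∸n+n≡m k≥1) (subst (_≤ D + 1) (+-comm (suc u) 1) (+-monoˡ-≤ 1 u<D))

    afterTurn : ℕ → State M
    afterTurn t = stateFrom k (t * L) (λ j → binsFromAfter j t)

    -- Within turn t + 1, the bins below j already hold the balls they hold at the end of the turn.
    inBinsDuring : ℕ → ℕ → ℕ → ℕ → Bool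
    inBinsDuring t j j' i = if j' <ᵇ j then binsFromAfter j' (suc t) i else binsFromAfter j' t i

    duringTurn : ℕ → ℕ → State M
    duringTurn t j = stateFrom k (suc t * L) (inBinsDuring t j)

    afterTurn-zero : afterTurn 0 ≡ replicate M nothing
    afterTurn-zero = tabulate-nothing M
      where
      tabulate-nothing : ∀ m → tabulate {n = m} (λ _ → nothing {A = ℕ}) ≡ replicate m nothing
      tabulate-nothing zero = refl
      tabulate-nothing (suc m) = cong (nothing ∷_) (tabulate-nothing m)

    insert-afterTurn : ∀ t → t < n → insertTurn L t (afterTurn t) ≡ duringTurn t 2
    insert-afterTurn t t<n = tabulate-cong same
      where
      levels-below : ℕ → ℕ
      levels-below i = count (λ u → binsFromAfter (2 + u) t i) D
      same : ∀ x → (if (t * L ≤ᵇ toℕ x) ∧ (toℕ x <ᵇ suc t * L) then just 1 else lookup (afterTurn t) x)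
                 ≡ (if toℕ x <ᵇ suc t * L then just (suc (levels-below (toℕ x))) else nothing)
      same x rewrite lookup∘tabulate (λ x → if toℕ x <ᵇ t * L then just (suc (levels-below (toℕ x))) else nothing) x
        with toℕ x
      ... | i with i <? t * L
      ...   | yes i<tL rewrite >⇒≤ᵇ≡false i<tL | <⇒<ᵇ≡true i<tL | <⇒<ᵇ≡true (≤-trans i<tL (m≤n+m (t * L) L)) = refl
      ...   | no i≮tL rewrite ≤⇒≤ᵇ≡true (≮⇒≥ i≮tL) | ≮⇒<ᵇ≡false i≮tL with i <? suc t * L
      ...     | yes i<tL+L rewrite <⇒<ᵇ≡true i<tL+L =
                cong (λ z → just (suc z)) (sym (trans (count-ext D (λ u _ → not-yet u)) (count-false D)))
        where
        not-yet : ∀ u → binsFromAfter (2 + u) t i ≡ false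
        not-yet u with binsFromAfter (2 + u) t i in i∈S
        ... | false = refl
        ... | true = ⊥-elim (i≮tL (binsFromAfter-early (2 + u) (s≤s (s≤s z≤n)) t (<⇒≤ t<n) i i∈S))
      ...     | no i≮tL+L rewrite ≮⇒<ᵇ≡false i≮tL+L = refl

    module MoveInto (t : ℕ) (t<n : t < n) (j₀ : ℕ) (2+j₀≤k : 2 + j₀ ≤ k) where
      j : ℕ
      j = 2 + j₀

      mixed : ℕ → ℕ → ℕ → Bool
      mixed = inBinsDuring t

      moved : ℕ → Bool
      moved i = binsFromAfter j (suc t) i ∧ not (binsFromAfter j t i)

      movedSet : Subset M
      movedSet = fromPred moved

      j≤1+k : j ≤ suc k
      j≤1+k = ≤-trans 2+j₀≤k (n≤1+n k)

      j₀<D : j₀ < D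
      j₀<D = ∸-monoˡ-≤ 1 2+j₀≤k

      moved-early : ∀ i → moved i ≡ true → i < suc t * L
      moved-early i i-moved = binsFromAfter-early j (s≤s (s≤s z≤n)) (suc t) t<n i (∧≡true⇒ˡ i-moved)

      ∣movedSet∣ : ∣ movedSet ∣ ≡ T j
      ∣movedSet∣ = trans (∣∣≡count movedSet) (trans (count-fromPred moved M ≤-refl)
        (+-cancelʳ-≡ (t * T j) _ _ (begin
          count moved M + t * T j              ≡⟨ cong (count moved M +_) (count-binsFromAfter j (s≤s (s≤s z≤n)) j≤1+k t (<⇒≤ t<n)) ⟨
          count moved M + count (binsFromAfter j t) M     ≡⟨ count-∧-not (binsFromAfter j t) (binsFromAfter j (suc t)) (binsFromAfter-grows j (s≤s (s≤s z≤n)) t) M ⟩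
          count (binsFromAfter j (suc t)) M               ≡⟨ count-binsFromAfter j (s≤s (s≤s z≤n)) j≤1+k (suc t) t<n ⟩
          T j + t * T j                        ∎)))
        where open ≡-Reasoning

      mixed-moved : ∀ i → moved i ≡ true → ∀ u → u < D → mixed j (2 + u) i ≡ (2 + u <ᵇ j)
      mixed-moved i i-moved u u<D with 2 + u <? j
      ... | yes 2+u<j rewrite <⇒<ᵇ≡true 2+u<j = binsFromAfter-nested (2 + u) j (<⇒≤ 2+u<j) j≤1+k (suc t) i (∧≡true⇒ˡ i-moved)
      ... | no 2+u≮j rewrite ≮⇒<ᵇ≡false 2+u≮j with binsFromAfter (2 + u) t i in i∈S
      ...   | false = refl
      ...   | true = ⊥-elim (false≢true (trans (sym (not≡true⇒ (∧≡true⇒ʳ {binsFromAfter j (suc t) i} i-moved)))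
                            (binsFromAfter-nested j (2 + u) (≮⇒≥ 2+u≮j) (≤-trans (2+u≤k u u<D) (n≤1+n k)) t i i∈S)))

      level-moved : ∀ i → moved i ≡ true → count (λ u → mixed j (2 + u) i) D ≡ j₀
      level-moved i i-moved = trans (count-ext D (mixed-moved i i-moved))
                                    (trans (count-<ᵇ j₀ D) (m≥n⇒m⊓n≡n (<⇒≤ j₀<D)))

      mixed-other : ∀ i u → u ≢ j₀ → mixed (suc j) (2 + u) i ≡ mixed j (2 + u) i
      mixed-other i u u≢j₀ with u <? j₀
      ... | yes u<j₀ rewrite <⇒<ᵇ≡true u<j₀ | <⇒<ᵇ≡true (m<n⇒m<1+n u<j₀) = refl
      ... | no u≮j₀ rewrite ≮⇒<ᵇ≡false u≮j₀ | ≮⇒<ᵇ≡false (λ u<1+j₀ → u≮j₀ (≤∧≢⇒< (≤-pred u<1+j₀) u≢j₀)) = refl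

      mixed-after : ∀ i → mixed (suc j) j i ≡ binsFromAfter j (suc t) i
      mixed-after i rewrite <⇒<ᵇ≡true (n<1+n j₀) = refl

      mixed-before : ∀ i → mixed j j i ≡ binsFromAfter j t i
      mixed-before i rewrite ≮⇒<ᵇ≡false (n≮n j₀) = refl

      moved-from : ∀ b → b ∈ movedSet → lookup (duringTurn t j) b ≡ just (pred j)
      moved-from b b∈ = trans (lookup∘tabulate _ b) (level-of (toℕ b) b-moved)
        where
        b-moved : moved (toℕ b) ≡ true
        b-moved = trans (sym (∈ᵇ-fromPred moved (toℕ b) (toℕ<n b))) (∈⇒∈ᵇ b∈)
        level-of : ∀ i → moved i ≡ true →
          (if i <ᵇ suc t * L then just (suc (count (λ u → mixed j (2 + u) i) D)) else nothing) ≡ just (pred j)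
        level-of i i-moved rewrite <⇒<ᵇ≡true (moved-early i i-moved) | level-moved i i-moved = refl

      moved-to : duringTurn t (suc j) ≡ tabulate (λ b → if does (b ∈? movedSet) then just j else lookup (duringTurn t j) b)
      moved-to = tabulate-cong same
        where
        same : ∀ x → (if toℕ x <ᵇ suc t * L then just (suc (count (λ u → mixed (suc j) (2 + u) (toℕ x)) D)) else nothing)
                   ≡ (if does (x ∈? movedSet) then just j else lookup (duringTurn t j) x)
        same x rewrite does-∈?≡lookup x movedSet | sym (∈ᵇ-lookup movedSet x) | ∈ᵇ-fromPred moved (toℕ x) (toℕ<n x)
                     | lookup∘tabulate (λ x → if toℕ x <ᵇ suc t * L then just (suc (count (λ u → mixed j (2 + u) (toℕ x)) D)) else nothing) x
          with toℕ x
        ... | i with moved i in i-moved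
        ... | true rewrite <⇒<ᵇ≡true (moved-early i i-moved) =
                cong (λ z → just (suc z)) (trans (sym (AddPoint.count-> (λ u → mixed (suc j) (2 + u) i) (λ u → mixed j (2 + u) i) j₀
                                                          (mixed-other i) (trans (mixed-after i) (∧≡true⇒ˡ i-moved))
                                                          (trans (mixed-before i) (not≡true⇒ (∧≡true⇒ʳ {binsFromAfter j (suc t) i} i-moved)))
                                                          D j₀<D))
                                                 (cong suc (level-moved i i-moved)))
        ... | false = cong (λ z → if i <ᵇ suc t * L then just (suc z) else nothing) (count-ext D (λ u _ → unchanged u))
          where
          not-moved : binsFromAfter j (suc t) i ≡ binsFromAfter j t i
          not-moved = stays (binsFromAfter j (suc t) i) (binsFromAfter j t i) i-moved (binsFromAfter-grows j (s≤s (s≤s z≤n)) t i)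
            where
            stays : ∀ a b → (a ∧ not b) ≡ false → (b ≡ true → a ≡ true) → a ≡ b
            stays true true _ _ = refl
            stays false false _ _ = refl
            stays false true _ b⇒a = b⇒a refl
          unchanged : ∀ u → mixed (suc j) (2 + u) i ≡ mixed j (2 + u) i
          unchanged u with u ≟ j₀
          ... | no u≢j₀ = mixed-other i u u≢j₀
          ... | yes refl = trans (mixed-after i) (trans not-moved (sym (mixed-before i)))

      move : Move (T j) j (duringTurn t j) (duringTurn t (suc j))
      move = movedSet , ∣movedSet∣ , moved-from , moved-to

    duringTurn-end : ∀ t → duringTurn t (suc k) ≡ afterTurn (suc t)
    duringTurn-end t = tabulate-cong λ x → cong (λ z → if toℕ x <ᵇ suc t * L then just (suc z) else nothing)
      (count-ext D (λ u u<D → cong (λ b → if b then binsFromAfter (2 + u) (suc t) (toℕ x) else binsFromAfter (2 + u) t (toℕ x))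
                                   (<⇒<ᵇ≡true (s≤s (2+u≤k u u<D)))))

    moves-duringTurn : ∀ t → t < n → ∀ e j → e + j ≡ suc k → 2 ≤ j → Moves l j (duringTurn t j) (afterTurn (suc t))
    moves-duringTurn t t<n zero j refl _ = subst (Moves l (suc k) (duringTurn t (suc k))) (duringTurn-end t) (done (n<1+n k))
    moves-duringTurn t t<n (suc e) (suc (suc j₀)) e+j≡ _ =
      step 2+j₀≤k (MoveInto.move t t<n j₀ 2+j₀≤k)
           (moves-duringTurn t t<n e (3 + j₀) (trans (+-suc e (2 + j₀)) e+j≡) (s≤s (s≤s z≤n)))
      where
      2+j₀≤k : 2 + j₀ ≤ k
      2+j₀≤k = subst (2 + j₀ ≤_) (suc-injective e+j≡) (m≤n+m (2 + j₀) e)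
    moves-duringTurn t t<n (suc e) (suc zero) _ (s≤s ())

    run-afterTurn : ∀ t → t ≤ n → Run l t (afterTurn t)
    run-afterTurn zero _ = subst (Run l 0) (sym afterTurn-zero) start
    run-afterTurn (suc t) t<n =
      turn (run-afterTurn t (≤-trans (n≤1+n t) t<n))
           (subst (λ σ → Moves l 2 σ (afterTurn (suc t))) (sym (insert-afterTurn t t<n))
                  (moves-duringTurn t t<n (k ∸ 1) 2 (trans (+-comm (k ∸ 1) 2) (cong suc (m+[n∸m]≡n k≥1))) ≤-refl))

    afterTurn-final : afterTurn n ≡ stateOf p
    afterTurn-final = trans (tabulate-cong same) (trans (sym (tabulate-cong (λ x → lookup-map x _ p))) (tabulate∘lookup (stateOf p)))
      where
      same : ∀ x → (if toℕ x <ᵇ n * L then just (suc (count (λ u → binsFromAfter (2 + u) n (toℕ x)) D)) else nothing)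
                 ≡ just (suc (toℕ (lookup p x)))
      same x rewrite <⇒<ᵇ≡true (toℕ<n x) = cong (λ z → just (suc z)) (begin
        count (λ u → binsFromAfter (2 + u) n (toℕ x)) D       ≡⟨ count-ext D (λ u u<D → trans (binsFromAfter-final (2 + u) (s≤s (s≤s z≤n)) (≤-trans (2+u≤k u u<D) (n≤1+n k)) (toℕ x))
                                                                                  (cong (2 + u ≤ᵇ_) (binOf-lookup p x))) ⟩
        count (λ u → u <ᵇ toℕ (lookup p x)) D       ≡⟨ count-<ᵇ (toℕ (lookup p x)) D ⟩
        D ⊓ toℕ (lookup p x)                        ≡⟨ m≥n⇒m⊓n≡n (∸-monoˡ-≤ 1 (toℕ<n (lookup p x))) ⟩
        toℕ (lookup p x)                            ∎)
        where open ≡-Reasoning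

    realisation : Configuration l n p
    realisation = afterTurn n , run-afterTurn n ≤-refl , afterTurn-final

module Extensions where

  open import Data.Nat
  open import Data.Nat.Properties
  open import Data.Bool using (Bool; true; false; if_then_else_; _∧_; _∨_; not)
  open import Data.Bool.Properties using (∧-identityʳ; not-involutive)
  open import Data.Fin using (Fin; toℕ; fromℕ<)
  open import Data.Fin.Properties using (toℕ<n; toℕ-fromℕ<)
  open import Data.Fin.Subset using (Subset)
  open import Data.Vec as Vec using (Vec; lookup; tabulate)
  open import Data.Vec.Properties using (lookup∘tabulate; tabulate-cong; tabulate∘lookup)
  open import Data.Product using (_×_; _,_; proj₁; proj₂)
  open import Data.Sum using (inj₁; inj₂)
  open import Data.Empty using (⊥-elim)
  open import Relation.Nullary using (yes; no)
  open import Relation.Binary.PropositionalEquality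
  open import Defs
  open Counting
  open LatticePaths using (Checkpoints)
  open TennisBalls

  ≤ᵇ≡not-suc≤ᵇ : ∀ c i → (c ≤ᵇ i) ≡ not (suc i ≤ᵇ c)
  ≤ᵇ≡not-suc≤ᵇ c i with c ≤? i
  ... | yes c≤i = trans (≤⇒≤ᵇ≡true c≤i) (sym (cong not (>⇒≤ᵇ≡false (s≤s c≤i))))
  ... | no c≰i = trans (>⇒≤ᵇ≡false (≰⇒> c≰i)) (sym (cong not (≤⇒≤ᵇ≡true (≰⇒> c≰i))))

  -- A set X satisfying the checkpoint conditions of the (i + 1)-th constituent is the union of
  -- the first i + 1 blocks of some ordered partition satisfying every bin condition: the bins
  -- i + 2, …, k take nested initial segments of the complement of X, and the bins 2, …, i + 1
  -- take, besides the whole complement, nested initial segments of X.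
  module Extension {k : ℕ} (l : Vec ℕ k) (n : ℕ) (k≥1 : 1 ≤ k) (i : Fin k) (X : Subset (n * total l))
                   (checkpoints : Checkpoints (headSum l (suc (toℕ i))) (total l) n X) where
    private
      L : ℕ
      L = total l
      M : ℕ
      M = n * L
      T : ℕ → ℕ
      T = tailSum l
      K : ℕ
      K = k ∸ 1
      j₀ : ℕ
      j₀ = 2 + toℕ i
      a : ℕ
      a = headSum l (suc (toℕ i))

      L≡a+T : L ≡ a + T j₀
      L≡a+T = split-total l (suc (toℕ i))

      tL≡ : ∀ t → t * L ≡ t * a + t * T j₀
      tL≡ t = trans (cong (t *_) L≡a+T) (*-distribˡ-+ t a (T j₀))

      tL≤M : ∀ t → t ≤ n → t * L ≤ M
      tL≤M t t≤n = *-monoˡ-≤ L t≤n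

    outside : ℕ → Bool
    outside ι = not (ι ∈ᵇ X) ∧ (ι <ᵇ M)

    count-outside : ∀ j → j ≤ M → count outside j + count (_∈ᵇ X) j ≡ j
    count-outside j j≤M = trans (cong (_+ count (_∈ᵇ X) j) (count-ext j (λ ι ι<j →
      trans (cong (not (ι ∈ᵇ X) ∧_) (<⇒<ᵇ≡true (<-≤-trans ι<j j≤M))) (∧-identityʳ (not (ι ∈ᵇ X))))))
      (count-not (_∈ᵇ X) j)

    outside-early : ∀ t → t ≤ n → t * T j₀ ≤ count outside (t * L)
    outside-early t t≤n = +-cancelˡ-≤ (t * a) _ _ (begin
      t * a + t * T j₀                         ≡⟨ tL≡ t ⟨
      t * L                                    ≡⟨ count-outside (t * L) (tL≤M t t≤n) ⟨
      count outside (t * L) + count (_∈ᵇ X) (t * L) ≤⟨ +-monoʳ-≤ (count outside (t * L)) (proj₁ checkpoints t t≤n) ⟩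
      count outside (t * L) + t * a            ≡⟨ +-comm (count outside (t * L)) (t * a) ⟩
      t * a + count outside (t * L)            ∎)
      where open ≤-Reasoning

    count-outside-total : count outside M ≡ n * T j₀
    count-outside-total = +-cancelʳ-≡ (n * a) _ _ (begin
      count outside M + n * a           ≡⟨ cong (count outside M +_) (proj₂ checkpoints) ⟨
      count outside M + count (_∈ᵇ X) M ≡⟨ count-outside M ≤-refl ⟩
      M                                 ≡⟨ tL≡ n ⟩
      n * a + n * T j₀                  ≡⟨ +-comm (n * a) (n * T j₀) ⟩
      n * T j₀ + n * a                  ∎)
      where open ≡-Reasoning

    extra : ℕ → ℕ
    extra j = n * (T j ∸ T j₀)

    upperPlan lowerPlan : ℕ → ℕ → Bool
    upperPlan j = first (n * T j) outside
    lowerPlan j ι = outside ι ∨ first (extra j) (_∈ᵇ X) ι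

    plannedBinsFrom : ℕ → ℕ → Bool
    plannedBinsFrom j = if j₀ ≤ᵇ j then upperPlan j else lowerPlan j

    plannedBinsFrom-upper : ∀ {j} → j₀ ≤ j → plannedBinsFrom j ≡ upperPlan j
    plannedBinsFrom-upper j₀≤j rewrite ≤⇒≤ᵇ≡true j₀≤j = refl

    plannedBinsFrom-lower : ∀ {j} → j < j₀ → plannedBinsFrom j ≡ lowerPlan j
    plannedBinsFrom-lower j<j₀ rewrite >⇒≤ᵇ≡false j<j₀ = refl

    plannedBinsFrom-bounded : ∀ j ι → plannedBinsFrom j ι ≡ true → ι < M
    plannedBinsFrom-bounded j ι ι∈ with j₀ ≤ᵇ j
    ... | true = <ᵇ≡true⇒< (∧≡true⇒ʳ {not (ι ∈ᵇ X)} (∧≡true⇒ˡ ι∈))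
    ... | false with ∨≡true⇒ {outside ι} ι∈
    ...   | inj₁ ι-out = <ᵇ≡true⇒< (∧≡true⇒ʳ {not (ι ∈ᵇ X)} ι-out)
    ...   | inj₂ ι∈X = ∈ᵇ⇒< X ι (∧≡true⇒ˡ ι∈X)

    plannedBinsFrom-antitone : ∀ j j' → 2 ≤ j' → j' ≤ j → plannedBinsFrom j ⊆ᵇ plannedBinsFrom j'
    plannedBinsFrom-antitone j j' 2≤j' j'≤j ι ι∈ with j₀ ≤? j' | j₀ ≤? j
    ... | yes j₀≤j' | yes j₀≤j rewrite ≤⇒≤ᵇ≡true j₀≤j | ≤⇒≤ᵇ≡true j₀≤j' =
            first-mono outside (*-monoʳ-≤ n (tailSum-antitone l j'≤j)) ι ι∈
    ... | yes j₀≤j' | no j₀≰j = ⊥-elim (j₀≰j (≤-trans j₀≤j' j'≤j))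
    ... | no j₀≰j' | yes j₀≤j rewrite ≤⇒≤ᵇ≡true j₀≤j | >⇒≤ᵇ≡false (≰⇒> j₀≰j') = ∨≡trueˡ _ (∧≡true⇒ˡ {outside ι} ι∈)
    ... | no j₀≰j' | no j₀≰j rewrite >⇒≤ᵇ≡false (≰⇒> j₀≰j) | >⇒≤ᵇ≡false (≰⇒> j₀≰j') with ∨≡true⇒ {outside ι} ι∈
    ...   | inj₁ ι-out = ∨≡trueˡ _ ι-out
    ...   | inj₂ ι-first = ∨≡trueʳ (outside ι) (first-mono (_∈ᵇ X) (*-monoʳ-≤ n (∸-monoˡ-≤ (T j₀) (tailSum-antitone l j'≤j))) ι ι-first)

    plannedBinsFrom-end : ∀ ι → plannedBinsFrom (suc k) ι ≡ false
    plannedBinsFrom-end ι rewrite ≤⇒≤ᵇ≡true (s≤s (toℕ<n i)) | tailSum-end l | *-zeroʳ n with outside ι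
    ... | true = refl
    ... | false = refl

    plannedBin : ℕ → ℕ
    plannedBin ι = count (λ u → plannedBinsFrom (2 + u) ι) K

    plannedBin<k : ∀ ι → plannedBin ι < k
    plannedBin<k ι = <-≤-trans (s≤s (count≤ _ K)) (≤-reflexive (m+[n∸m]≡n k≥1))

    partition : Vec (Fin k) M
    partition = tabulate (λ x → fromℕ< (plannedBin<k (toℕ x)))

    binOf-partition : ∀ ι → ι < M → binOf partition ι ≡ suc (plannedBin ι)
    binOf-partition ι ι<M = subst (λ z → binOf partition z ≡ suc (plannedBin z)) (toℕ-fromℕ< ι<M)
      (trans (binOf-lookup partition x) (cong suc (trans (cong toℕ (lookup∘tabulate _ x)) (toℕ-fromℕ< (plannedBin<k (toℕ x))))))
      where x = fromℕ< ι<M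

    binsFrom-partition : ∀ j → 2 ≤ j → j ≤ suc k → ∀ ι → binsFrom partition j ι ≡ plannedBinsFrom j ι
    binsFrom-partition j 2≤j j≤1+k ι with ι <? M
    ... | no ι≮M rewrite binOf-out partition ι (≮⇒≥ ι≮M) with plannedBinsFrom j ι in ι∈
    ...   | false = >⇒≤ᵇ≡false {0} {j} (≤-trans (s≤s z≤n) 2≤j)
    ...   | true = ⊥-elim (ι≮M (plannedBinsFrom-bounded j ι ι∈))
    binsFrom-partition (suc zero) (s≤s ()) j≤1+k ι | yes ι<M
    binsFrom-partition (suc (suc w)) 2≤j j≤1+k ι | yes ι<M rewrite binOf-partition ι ι<M with w <? K
    ... | yes w<K = count-downClosed (λ u → plannedBinsFrom (2 + u) ι) K
                      (λ u v u≤v _ v∈ → plannedBinsFrom-antitone (2 + v) (2 + u) (s≤s (s≤s z≤n)) (s≤s (s≤s u≤v)) ι v∈) w w<K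
    ... | no w≮K = trans (>⇒≤ᵇ≡false {plannedBin ι} {suc w} (s≤s (≤-trans (count≤ _ K) (≮⇒≥ w≮K))))
                         (sym (subst (λ z → plannedBinsFrom z ι ≡ false) (sym w+2≡1+k) (plannedBinsFrom-end ι)))
      where
      w+2≡1+k : suc (suc w) ≡ suc k
      w+2≡1+k = ≤-antisym j≤1+k (s≤s (subst (_≤ suc w) (m+[n∸m]≡n k≥1) (s≤s (≮⇒≥ w≮K))))

    PlannedBinCondition : ℕ → Set
    PlannedBinCondition j = (∀ t → t ≤ n → t * T j ≤ count (plannedBinsFrom j) (t * L)) × count (plannedBinsFrom j) M ≡ n * T j

    upper-plannedBinCondition : ∀ j → j₀ ≤ j → PlannedBinCondition j
    upper-plannedBinCondition j j₀≤j = early , total-count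
      where
      Tj≤Tj₀ : T j ≤ T j₀
      Tj≤Tj₀ = tailSum-antitone l j₀≤j
      count-upper : ∀ m → count (plannedBinsFrom j) m ≡ n * T j ⊓ count outside m
      count-upper m = trans (cong (λ P → count P m) (plannedBinsFrom-upper j₀≤j)) (count-first (n * T j) outside m)
      early : ∀ t → t ≤ n → t * T j ≤ count (plannedBinsFrom j) (t * L)
      early t t≤n = subst (t * T j ≤_) (sym (count-upper (t * L)))
                      (⊓-glb (*-monoˡ-≤ (T j) t≤n) (≤-trans (*-monoʳ-≤ t Tj≤Tj₀) (outside-early t t≤n)))
      total-count : count (plannedBinsFrom j) M ≡ n * T j
      total-count = trans (count-upper M) (trans (cong (n * T j ⊓_) count-outside-total) (m≤n⇒m⊓n≡m (*-monoʳ-≤ n Tj≤Tj₀)))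

    lower-plannedBinCondition : ∀ j → j < j₀ → PlannedBinCondition j
    lower-plannedBinCondition j j<j₀ = early , total-count
      where
      Tj₀≤Tj : T j₀ ≤ T j
      Tj₀≤Tj = tailSum-antitone l (<⇒≤ j<j₀)
      Tj∸Tj₀+Tj₀ : T j ∸ T j₀ + T j₀ ≡ T j
      Tj∸Tj₀+Tj₀ = m∸n+n≡m Tj₀≤Tj
      count-lower : ∀ m → count (plannedBinsFrom j) m ≡ count outside m + extra j ⊓ count (_∈ᵇ X) m
      count-lower m = trans (cong (λ P → count P m) (plannedBinsFrom-lower j<j₀))
        (trans (count-∨ outside (first (extra j) (_∈ᵇ X)) disjoint m) (cong (count outside m +_) (count-first (extra j) (_∈ᵇ X) m)))
        where
        disjoint : ∀ ι → outside ι ≡ true → first (extra j) (_∈ᵇ X) ι ≡ false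
        disjoint ι ι-out with ι ∈ᵇ X
        ... | false = refl
        ... | true = ⊥-elim (false≢true ι-out)
      early : ∀ t → t ≤ n → t * T j ≤ count (plannedBinsFrom j) (t * L)
      early t t≤n rewrite count-lower (t * L) with extra j ≤? count (_∈ᵇ X) (t * L)
      ... | yes extra≤ rewrite m≤n⇒m⊓n≡m extra≤ = begin
        t * T j                            ≡⟨ cong (t *_) Tj∸Tj₀+Tj₀ ⟨
        t * (T j ∸ T j₀ + T j₀)            ≡⟨ *-distribˡ-+ t (T j ∸ T j₀) (T j₀) ⟩
        t * (T j ∸ T j₀) + t * T j₀        ≡⟨ +-comm (t * (T j ∸ T j₀)) (t * T j₀) ⟩
        t * T j₀ + t * (T j ∸ T j₀)        ≤⟨ +-mono-≤ (outside-early t t≤n) (*-monoˡ-≤ (T j ∸ T j₀) t≤n) ⟩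
        count outside (t * L) + extra j    ∎
        where open ≤-Reasoning
      ... | no extra≰ rewrite m≥n⇒m⊓n≡n (<⇒≤ (≰⇒> extra≰)) =
            subst (t * T j ≤_) (sym (count-outside (t * L) (tL≤M t t≤n))) (*-monoʳ-≤ t (tailSum≤total l j))
      extra≤na : extra j ≤ n * a
      extra≤na = *-monoʳ-≤ n (subst (T j ∸ T j₀ ≤_) (m+n∸n≡m a (T j₀))
                   (∸-monoˡ-≤ (T j₀) (subst (T j ≤_) L≡a+T (tailSum≤total l j))))
      total-count : count (plannedBinsFrom j) M ≡ n * T j
      total-count = begin
        count (plannedBinsFrom j) M                         ≡⟨ count-lower M ⟩
        count outside M + extra j ⊓ count (_∈ᵇ X) M   ≡⟨ cong₂ (λ u v → u + extra j ⊓ v) count-outside-total (proj₂ checkpoints) ⟩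
        n * T j₀ + extra j ⊓ (n * a)                  ≡⟨ cong (n * T j₀ +_) (m≤n⇒m⊓n≡m extra≤na) ⟩
        n * T j₀ + n * (T j ∸ T j₀)                   ≡⟨ *-distribˡ-+ n (T j₀) (T j ∸ T j₀) ⟨
        n * (T j₀ + (T j ∸ T j₀))                     ≡⟨ cong (n *_) (trans (+-comm (T j₀) _) Tj∸Tj₀+Tj₀) ⟩
        n * T j                                       ∎
        where open ≡-Reasoning

    plannedBinCondition : ∀ j → PlannedBinCondition j
    plannedBinCondition j with j₀ ≤? j
    ... | yes j₀≤j = upper-plannedBinCondition j j₀≤j
    ... | no j₀≰j = lower-plannedBinCondition j (≰⇒> j₀≰j)

    partition-binCondition : ∀ j → 2 ≤ j → j ≤ suc k → BinCondition l n partition j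
    partition-binCondition j 2≤j j≤1+k =
      (λ t t≤n → subst (t * T j ≤_) (sym (same (t * L))) (proj₁ (plannedBinCondition j) t t≤n)) ,
      trans (same M) (proj₂ (plannedBinCondition j))
      where
      same : ∀ m → count (binsFrom partition j) m ≡ count (plannedBinsFrom j) m
      same m = count-ext m (λ ι _ → binsFrom-partition j 2≤j j≤1+k ι)

    plannedBinsFrom-j₀ : ∀ ι → ι < M → plannedBinsFrom j₀ ι ≡ not (ι ∈ᵇ X)
    plannedBinsFrom-j₀ ι ι<M rewrite ≤⇒≤ᵇ≡true (≤-refl {j₀}) with ι ∈ᵇ X in ι∈X
    ... | true = refl
    ... | false rewrite <⇒<ᵇ≡true ι<M = <⇒<ᵇ≡true rank<
      where
      ι-out : outside ι ≡ true
      ι-out = trans (cong (λ b → not b ∧ (ι <ᵇ M)) ι∈X) (<⇒<ᵇ≡true ι<M)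
      rank< : count outside ι < n * T j₀
      rank< = subst (_≤ n * T j₀) (count-suc-true outside ι ι-out)
                (subst (count outside (suc ι) ≤_) count-outside-total (count-monoʳ outside ι<M))

    prefixUnion-partition : prefixUnion partition i ≡ X
    prefixUnion-partition = trans (tabulate-cong same) (tabulate∘lookup X)
      where
      same : ∀ x → (toℕ (lookup partition x) ≤ᵇ toℕ i) ≡ lookup X x
      same x = begin
        toℕ (lookup partition x) ≤ᵇ toℕ i           ≡⟨ ≤ᵇ≡not-suc≤ᵇ (toℕ (lookup partition x)) (toℕ i) ⟩
        not (j₀ ≤ᵇ suc (toℕ (lookup partition x)))  ≡⟨ cong (λ z → not (j₀ ≤ᵇ z)) (binOf-lookup partition x) ⟨
        not (binsFrom partition j₀ (toℕ x))         ≡⟨ cong not (binsFrom-partition j₀ (s≤s (s≤s z≤n)) (s≤s (toℕ<n i)) (toℕ x)) ⟩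
        not (plannedBinsFrom j₀ (toℕ x))                  ≡⟨ cong not (plannedBinsFrom-j₀ (toℕ x) (toℕ<n x)) ⟩
        not (not (toℕ x ∈ᵇ X))                      ≡⟨ not-involutive (toℕ x ∈ᵇ X) ⟩
        toℕ x ∈ᵇ X                                  ≡⟨ ∈ᵇ-lookup X x ⟩
        lookup X x                                  ∎
        where open ≡-Reasoning

open Counting
open PathMatroids
open LatticePaths
open TennisBalls
open Sufficiency
open Extensions

open Equivalence using (to; from)

infix 4 _≋_
_≋_ : ∀ {N} → (Subset N → Set) → (Subset N → Set) → Set
B ≋ B' = ∀ X → B X ⇔ B' X

≋-sym : ∀ {N} {B B' : Subset N → Set} → B ≋ B' → B' ≋ B
≋-sym B≋B' X = ⇔-sym (B≋B' X)

≋-trans : ∀ {N} {B B' B'' : Subset N → Set} → B ≋ B' → B' ≋ B'' → B ≋ B''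
≋-trans B≋B' B'≋B'' X = ⇔-trans (B≋B' X) (B'≋B'' X)

independent-transfer : ∀ {N} {B B' : Subset N → Set} → B ≋ B' → ∀ {I} → Independent B I → Independent B' I
independent-transfer B≋B' (X , X-basis , I⊆X) = X , to (B≋B' X) X-basis , I⊆X

hasRank-transfer : ∀ {N} {B B' : Subset N → Set} → B ≋ B' → ∀ {X r} → HasRank B X r → HasRank B' X r
hasRank-transfer B≋B' ((I , I-ind , I⊆X , ∣I∣) , maximal) =
  (I , independent-transfer B≋B' I-ind , I⊆X , ∣I∣) ,
  λ I' I'-ind I'⊆X → maximal I' (independent-transfer (≋-sym B≋B') I'-ind) I'⊆X

isFlat-transfer : ∀ {N} {B B' : Subset N → Set} → B ≋ B' → ∀ {F} → IsFlat B F → IsFlat B' F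
isFlat-transfer B≋B' F-flat e e∉F r r' r-rank r'-rank =
  F-flat e e∉F r r' (hasRank-transfer (≋-sym B≋B') r-rank) (hasRank-transfer (≋-sym B≋B') r'-rank)

isMatroid-transfer : ∀ {N} {B B' : Subset N → Set} → B ≋ B' → IsMatroid B → IsMatroid B'
isMatroid-transfer B≋B' ((X , X-basis) , exchange) =
  (X , to (B≋B' X) X-basis) ,
  λ X Y X-basis Y-basis x x∈X x∉Y →
    let (y , y∈Y , y∉X , Z-basis) = exchange X Y (from (B≋B' X) X-basis) (from (B≋B' Y) Y-basis) x x∈X x∉Y
    in y , y∈Y , y∉X , to (B≋B' _) Z-basis

isQuotient-transfer : ∀ {N} {B₁ B₁' B₂ B₂' : Subset N → Set} → B₁ ≋ B₁' → B₂ ≋ B₂' →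
  IsQuotient B₁ B₂ → IsQuotient B₁' B₂'
isQuotient-transfer B₁≋B₁' B₂≋B₂' quotient F F-flat =
  isFlat-transfer B₂≋B₂' (quotient F (isFlat-transfer (≋-sym B₁≋B₁') F-flat))

count-cast : ∀ {m m'} (eq : m ≡ m') (X : Subset m) j → count (_∈ᵇ cast eq X) j ≡ count (_∈ᵇ X) j
count-cast refl X j = cong (λ Z → count (_∈ᵇ Z) j) (cast-is-id refl X)

∣cast∣ : ∀ {m m'} (eq : m ≡ m') (X : Subset m) → ∣ cast eq X ∣ ≡ ∣ X ∣
∣cast∣ refl X = cong ∣_∣ (cast-is-id refl X)

module Constituents {k : ℕ} (k≥1 : 1 ≤ k) (l : Vec ℕ k) (n : ℕ) where
  private
    L : ℕ
    L = total l
    M : ℕ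
    M = n * L

  northSteps eastSteps : ℕ → ℕ
  northSteps i = headSum l (suc i)
  eastSteps i = tailSum l (suc (suc i))

  L≡ : ∀ i → L ≡ northSteps i + eastSteps i
  L≡ i = split-total l (suc i)

  height : ℕ → ℕ → ℕ
  height i j = heightAt j (tbpWord (northSteps i) (eastSteps i) n)

  height-isPathHeight : ∀ i → IsPathHeight M (height i) (n * northSteps i)
  height-isPathHeight i = record
    { height-zero = refl
    ; height-step = heightAt-step (tbpWord (northSteps i) (eastSteps i) n)
    ; height-mono = heightAt-mono (tbpWord (northSteps i) (eastSteps i) n)
    ; height-end = heightAt-tbpWord-end (northSteps i) (eastSteps i) n M (≤-reflexive (cong (n *_) (sym (L≡ i))))
    }

  tbpBasis≋bounded : ∀ i → TbpBasis l n (suc i) ≋ BoundedBasis (height i) (n * northSteps i)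
  tbpBasis≋bounded i X = mk⇔
    (λ tbp → let (bounded , ∣X∣) = nested⇒bounded P (cast eq X) tbp in
      (λ j → subst (_≤ height i j) (count-cast eq X j) (bounded j)) ,
      trans (sym (∣cast∣ eq X)) (trans ∣X∣ (countN-tbpWord (northSteps i) (eastSteps i) n)))
    (λ (bounded , ∣X∣) → bounded⇒nested P (cast eq X)
      ((λ j → subst (_≤ height i j) (sym (count-cast eq X j)) (bounded j)) ,
       trans (∣cast∣ eq X) (trans ∣X∣ (sym (countN-tbpWord (northSteps i) (eastSteps i) n)))))
    where
    eq : n * L ≡ n * (northSteps i + eastSteps i)
    eq = cong (n *_) (L≡ i)
    P : Vec Step (n * (northSteps i + eastSteps i))
    P = tbpPath (northSteps i) (eastSteps i) n

  checkpoints≋bounded : ∀ i → Checkpoints (northSteps i) L n ≋ BoundedBasis (height i) (n * northSteps i)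
  checkpoints≋bounded i X = mk⇔
    (λ cp → checkpoints⇒bounded (northSteps i) (eastSteps i) n (cong (n *_) (L≡ i)) X
              (subst (λ L′ → Checkpoints (northSteps i) L′ n X) (L≡ i) cp))
    (λ bd → subst (λ L′ → Checkpoints (northSteps i) L′ n X) (sym (L≡ i))
              (bounded⇒checkpoints (northSteps i) (eastSteps i) n (cong (n *_) (L≡ i)) X bd))

  ∈ᵇ-prefixUnion : (p : Vec (Fin k) M) (i : Fin k) → ∀ j → j < M → (j ∈ᵇ prefixUnion p i) ≡ not (binsFrom p (2 + toℕ i) j)
  ∈ᵇ-prefixUnion p i j j<M = subst (λ z → (z ∈ᵇ prefixUnion p i) ≡ not (binsFrom p (2 + toℕ i) z)) (toℕ-fromℕ< j<M) (begin
    toℕ x ∈ᵇ prefixUnion p i                  ≡⟨ ∈ᵇ-lookup (prefixUnion p i) x ⟩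
    lookup (prefixUnion p i) x                ≡⟨ lookup∘tabulate _ x ⟩
    toℕ (lookup p x) ≤ᵇ toℕ i                 ≡⟨ ≤ᵇ≡not-suc≤ᵇ (toℕ (lookup p x)) (toℕ i) ⟩
    not (2 + toℕ i ≤ᵇ suc (toℕ (lookup p x))) ≡⟨ cong (λ z → not (2 + toℕ i ≤ᵇ z)) (binOf-lookup p x) ⟨
    not (binsFrom p (2 + toℕ i) (toℕ x))      ∎)
    where
    open ≡-Reasoning
    x : Fin M
    x = fromℕ< j<M

  count-prefixUnion : (p : Vec (Fin k) M) (i : Fin k) → ∀ m → m ≤ M →
    count (_∈ᵇ prefixUnion p i) m + count (binsFrom p (2 + toℕ i)) m ≡ m
  count-prefixUnion p i m m≤M =
    trans (cong (_+ count (binsFrom p (2 + toℕ i)) m) (count-ext m (λ j j<m → ∈ᵇ-prefixUnion p i j (<-≤-trans j<m m≤M))))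
          (count-not (binsFrom p (2 + toℕ i)) m)

  private
    ≤-complement : ∀ {x y u v} → x + y ≡ u + v → v ≤ y → x ≤ u
    ≤-complement {x} {y} {u} {v} x+y≡u+v v≤y = +-cancelʳ-≤ v x u (≤-trans (+-monoʳ-≤ x v≤y) (≤-reflexive x+y≡u+v))

    tL≡ : ∀ i t → t * L ≡ t * northSteps i + t * eastSteps i
    tL≡ i t = trans (cong (t *_) (L≡ i)) (*-distribˡ-+ t (northSteps i) (eastSteps i))

  -- Bins 1, …, i + 1 and bins i + 2, …, k split every initial segment of the balls.
  prefixUnion-checkpoints⇔binCondition : (p : Vec (Fin k) M) (i : Fin k) →
    Checkpoints (northSteps (toℕ i)) L n (prefixUnion p i) ⇔ BinCondition l n p (2 + toℕ i)
  prefixUnion-checkpoints⇔binCondition p i = mk⇔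
    (λ (early , total) →
      (λ t t≤n → ≤-complement (trans (+-comm (t * b) (t * a)) (trans (sym (tL≡ i′ t))
                   (trans (sym (count-prefixUnion p i (t * L) (*-monoˡ-≤ L t≤n))) (+-comm (A (t * L)) (B (t * L)))))) (early t t≤n)) ,
      +-cancelʳ-≡ (n * a) _ _ (trans (+-comm (B M) (n * a)) (trans (cong (_+ B M) (sym total))
                   (trans (count-prefixUnion p i M ≤-refl) (trans (tL≡ i′ n) (+-comm (n * a) (n * b)))))))
    (λ (early , total) →
      (λ t t≤n → ≤-complement (trans (count-prefixUnion p i (t * L) (*-monoˡ-≤ L t≤n)) (tL≡ i′ t)) (early t t≤n)) ,
      +-cancelʳ-≡ (n * b) _ _ (trans (cong (A M +_) (sym total)) (trans (count-prefixUnion p i M ≤-refl) (tL≡ i′ n))))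
    where
    i′ : ℕ
    i′ = toℕ i
    a : ℕ
    a = northSteps i′
    b : ℕ
    b = eastSteps i′
    A B : ℕ → ℕ
    A = count (_∈ᵇ prefixUnion p i)
    B = count (binsFrom p (2 + i′))

  constituent≋checkpoints : (i : Fin k) → ConstituentBasis (Configuration l n) i ≋ Checkpoints (northSteps (toℕ i)) L n
  constituent≋checkpoints i X = mk⇔
    (λ { (p , conf , refl) → from (prefixUnion-checkpoints⇔binCondition p i)
                               (Necessity.configuration⇒binCondition l n p conf (2 + toℕ i) (s≤s (s≤s z≤n)) (s≤s (toℕ<n i))) })
    (λ cp → let open Extension l n k≥1 i X cp in
      partition , Realisation.realisation l n k≥1 partition partition-binCondition , prefixUnion-partition)

  constituent≋bounded : (i : Fin k) → ConstituentBasis (Configuration l n) i ≋ BoundedBasis (height (toℕ i)) (n * northSteps (toℕ i))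
  constituent≋bounded i = ≋-trans (constituent≋checkpoints i) (checkpoints≋bounded (toℕ i))

  constituent-isMatroid : (i : Fin k) → IsMatroid (ConstituentBasis (Configuration l n) i)
  constituent-isMatroid i = isMatroid-transfer (≋-sym (constituent≋bounded i)) (PathMatroid.isMatroid (height-isPathHeight (toℕ i)))

  -- Raising the index turns E steps of the tbp path into N steps, so the height difference grows.
  constituent-isQuotient : (i j : Fin k) → suc (toℕ i) ≡ toℕ j →
    IsQuotient (ConstituentBasis (Configuration l n) i) (ConstituentBasis (Configuration l n) j)
  constituent-isQuotient i j i+1≡j =
    isQuotient-transfer (≋-sym (constituent≋bounded i)) (≋-sym (constituent≋bounded j))
      (Quotient.isQuotient (height-isPathHeight (toℕ i)) (height-isPathHeight (toℕ j))
        (heightAt-slack-mono (tbpWord-≼ (northSteps (toℕ i)) (eastSteps (toℕ i)) (northSteps (toℕ j)) (eastSteps (toℕ j)) n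
                                        northSteps-mono (trans (sym (L≡ (toℕ i))) (L≡ (toℕ j))))))
    where
    northSteps-mono : northSteps (toℕ i) ≤ northSteps (toℕ j)
    northSteps-mono = ≤-complement (trans (sym (L≡ (toℕ i))) (L≡ (toℕ j)))
                      (tailSum-antitone l (s≤s (s≤s (≤-trans (n≤1+n (toℕ i)) (≤-reflexive i+1≡j)))))

  constituents⇒configuration : ∀ p → (∀ i → ConstituentBasis (Configuration l n) i (prefixUnion p i)) → Configuration l n p
  constituents⇒configuration p bases = Realisation.realisation l n k≥1 p binConditions
    where
    binConditions : ∀ j → 2 ≤ j → j ≤ suc k → BinCondition l n p j
    binConditions (suc (suc w)) _ j≤1+k with m≤n⇒m<n∨m≡n j≤1+k
    ... | inj₂ refl = binCondition-last l n p
    ... | inj₁ (s≤s 2+w≤k) = subst (λ z → BinCondition l n p (2 + z)) (toℕ-fromℕ< w<k)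
        (to (prefixUnion-checkpoints⇔binCondition p i) (to (constituent≋checkpoints i (prefixUnion p i)) (bases i)))
      where
      w<k : w < k
      w<k = ≤-trans (n≤1+n (suc w)) 2+w≤k
      i : Fin k
      i = fromℕ< w<k
    binConditions (suc zero) (s≤s ()) _

theorem2p4 : (k : ℕ) → 1 ≤ k → (l : Vec ℕ k) → (∀ j → 0 < lookup l j) →
    (n : ℕ) → 1 ≤ n →
    IsFlagMatroid (Configuration l n) ×
    (∀ (i : Fin k) (X : Subset (n * total l)) →
      ConstituentBasis (Configuration l n) i X ⇔ TbpBasis l n (suc (toℕ i)) X)
theorem2p4 k k≥1 l pos n n≥1 =
  ( Necessity.configuration⇒isOrderedPartition l n pos n≥1
  , constituent-isMatroid
  , constituent-isQuotient
  , (λ p _ bases → constituents⇒configuration p bases) ) ,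
  λ i X → ⇔-trans (constituent≋bounded i X) (⇔-sym (tbpBasis≋bounded (toℕ i) X))
  where open Constituents k≥1 l n
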